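{- Let $n\ge 1$ and $k\ge 1$ be integers, and for each $1\le i\le n$ let $S_i=(a_{i(1)},a_{i(2)},\ldots,a_{i(m_i)})$ be a non-empty ordered tuple of positive integers ($m_i\ge 1$). Then the chromatic polynomial of the clique-theta graph $T(1,S_1,\ldots,S_n,k)$ is \[ \left[(X)_{a_{n(m_n)}+k}\left(\prod_{i=1}^{n-1}(X-k-1)_{a_{i(m_i)}-1}\right)\left(\prod_{i=1}^n\prod_{l=1}^{m_i-1}(X-a_{i(l+1)}-1)_{a_{i(l)}-1}\right)\right] \] \[ \times \left[k(X-k)^{n-1}\prod_{i=1}^n r(1,a_{i(1)},\ldots,a_{i(m_i)};X)\;+\;\prod_{i=1}^n r(1,a_{i(1)},\ldots,a_{i(m_i)},k;X)\right]. \]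
   Context: All graphs are finite and simple; $P_G(X)$ denotes the chromatic polynomial of $G$ (the monic polynomial counting proper $q$-colourings at $X=q\in\mathbb{N}$). For an integer $j\ge 0$, $(X)_j=X(X-1)\cdots(X-j+1)$ is the falling factorial, with $(X)_0=1$; likewise $(X-c)_j=(X-c)(X-c-1)\cdots(X-c-j+1)$. The clique-path $L(b_1,\ldots,b_t)$ (for positive integers $b_i$) is obtained from a path on vertices $1,\ldots,t$ by replacing vertex $i$ with a clique of size $b_i$ and joining every vertex of the $i$th clique to every vertex of the $(i+1)$th clique, for $1\le i<t$. The clique-theta graph $T(1,S_1,\ldots,S_n,k)$, for non-empty tuples $S_i=(a_{i(1)},\ldots,a_{i(m_i)})$ of positive integers, is obtained by taking the $n$ clique-paths $L(1,a_{i(1)},\ldots,a_{i(m_i)},k)$, $1\le i\le n$, identifying their initial single-vertex cliques into one vertex, and identifying their final cliques of size $k$ into one clique of size $k$. For positive integers $b_1,\ldots,b_t$, the polynomial $r(1,b_1,\ldots,b_t;X)$ is defined by \[ r(1,b_1,\ldots,b_t;X)=\frac{1}{X}\left(\prod_{i=1}^t(X-b_i)-\prod_{i=1}^t(-b_i)\right). \] -}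

module Defs where

open import Data.Bool using (Bool; true; false; _∧_; _∨_; not; if_then_else_)
open import Data.Nat as ℕ using (ℕ; zero; suc; _∸_; _≡ᵇ_)
open import Data.Integer as ℤ using (ℤ; +_; -_)
open import Data.List as List using (List; []; _∷_; _++_; map; concatMap; concat; filter; length; upTo; foldr; zip; lookup)
open import Data.List.NonEmpty as List⁺ using (List⁺; toList; last)
open import Data.Product using (_×_; _,_)
open import Relation.Binary.PropositionalEquality using (_≡_)

-- Polynomials over ℤ as lists of coefficients (constant term first).

Poly : Set
Poly = List ℤ

constP : ℤ → Poly
constP c = c ∷ []

Xp : Poly
Xp = + 0 ∷ + 1 ∷ []

infixl 6 _+P_ _-P_
infixl 7 _*P_

_+P_ : Poly → Poly → Poly
[] +P q = q
(a ∷ p) +P [] = a ∷ p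
(a ∷ p) +P (b ∷ q) = (a ℤ.+ b) ∷ (p +P q)

scaleP : ℤ → Poly → Poly
scaleP c = map (c ℤ.*_)

negP : Poly → Poly
negP = map -_

_-P_ : Poly → Poly → Poly
p -P q = p +P negP q

_*P_ : Poly → Poly → Poly
[] *P q = []
(a ∷ p) *P q = scaleP a q +P (+ 0 ∷ (p *P q))

prodP : List Poly → Poly
prodP = foldr _*P_ (constP (+ 1))

powP : Poly → ℕ → Poly
powP p zero = constP (+ 1)
powP p (suc j) = p *P powP p j

-- Division by X of a polynomial with zero constant term: drop that term.
divX : Poly → Poly
divX [] = []
divX (_ ∷ p) = p

evalP : Poly → ℤ → ℤ
evalP [] x = + 0
evalP (a ∷ p) x = a ℤ.+ x ℤ.* evalP p x

X-_ : ℕ → Poly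
X- c = Xp -P constP (+ c)

-- Falling factorial (X - c)_j = (X-c)(X-c-1)...(X-c-j+1); (X)_j = (X - 0)_j.
fall : ℕ → ℕ → Poly
fall c zero = constP (+ 1)
fall c (suc j) = (X- c) *P fall (suc c) j

-- r(1, b_1, ..., b_t; X) = (1/X) (∏ (X - b_i) - ∏ (-b_i))
r : List ℕ → Poly
r bs = divX (prodP (map X-_ bs) -P constP (foldr (λ b acc → (- (+ b)) ℤ.* acc) (+ 1) bs))

-- Finite simple graphs given by a list of (distinct) vertices and a
-- symmetric, irreflexive Boolean adjacency; counting proper colourings.

record Graph : Set₁ where
  field
    V     : Set
    verts : List V
    adj   : V → V → Bool

colourings : ℕ → ℕ → List (List ℕ)
colourings q zero = [] ∷ []
colourings q (suc N) = concatMap (λ c → map (c ∷_) (colourings q N)) (upTo q)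

properᵇ : {V : Set} → (V → V → Bool) → List V → List ℕ → Bool
properᵇ adj [] _ = true
properᵇ adj (v ∷ vs) [] = true
properᵇ adj (v ∷ vs) (c ∷ cs) =
  foldr _∧_ true (map (λ { (w , d) → not (adj v w ∧ (c ≡ᵇ d)) }) (zip vs cs))
  ∧ properᵇ adj vs cs

numColourings : Graph → ℕ → ℕ
numColourings G q =
  length (filter (λ f → Data.Bool._≟_ (properᵇ (Graph.adj G) (Graph.verts G) f) true)
                 (colourings q (length (Graph.verts G))))
  where import Data.Bool

-- The clique-theta graph T(1, S_1, ..., S_n, k).
-- Vertices: the apex, vertex c of the l-th clique (0-based) of path i
-- (0-based), and vertex c of the final k-clique.

data TV : Set where
  apex  : TV
  inner : ℕ → ℕ → ℕ → TV
  final : ℕ → TV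

-- m_i, the length of the i-th tuple (0-based index)
lenAt : List (List⁺ ℕ) → ℕ → ℕ
lenAt [] i = 0
lenAt (S ∷ Ss) zero = List⁺.length S
lenAt (S ∷ Ss) (suc i) = lenAt Ss i

adjDir : List (List⁺ ℕ) → TV → TV → Bool
adjDir Ss apex (inner i l c) = l ≡ᵇ 0
adjDir Ss (inner i l c) (inner i' l' c') =
  ((i ≡ᵇ i') ∧ (l ≡ᵇ l') ∧ not (c ≡ᵇ c')) ∨ ((i ≡ᵇ i') ∧ (l' ≡ᵇ suc l))
adjDir Ss (inner i l c) (final c') = suc l ≡ᵇ lenAt Ss i
adjDir Ss (final c) (final c') = not (c ≡ᵇ c')
adjDir Ss _ _ = false

thetaAdj : List (List⁺ ℕ) → TV → TV → Bool
thetaAdj Ss u v = adjDir Ss u v ∨ adjDir Ss v u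

indexed : {A : Set} → List A → List (ℕ × A)
indexed xs = zip (upTo (length xs)) xs

thetaVerts : List (List⁺ ℕ) → ℕ → List TV
thetaVerts Ss k =
  apex ∷
  (concatMap (λ { (i , S) →
      concatMap (λ { (l , a) → map (inner i l) (upTo a) }) (indexed (toList S)) })
    (indexed Ss)
  ++ map final (upTo k))

cliqueTheta : List (List⁺ ℕ) → ℕ → Graph
cliqueTheta Ss k = record { V = TV ; verts = thetaVerts Ss k ; adj = thetaAdj Ss }

consecPairs : List ℕ → List (ℕ × ℕ)
consecPairs (a ∷ a' ∷ t) = (a , a') ∷ consecPairs (a' ∷ t)
consecPairs _ = []

-- S₀ = (S_1, …, S_{n-1}), Sn = S_n
prop4RHS : List (List⁺ ℕ) → List⁺ ℕ → ℕ → Poly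
prop4RHS S₀ Sn k =
  (fall 0 (last Sn ℕ.+ k)
    *P prodP (map (λ S → fall (suc k) (last S ∸ 1)) S₀)
    *P prodP (map (λ S → prodP (map (λ { (a , a') → fall (suc a') (a ∸ 1) })
                                     (consecPairs (toList S))))
                  (S₀ ++ Sn ∷ [])))
  *P (  (constP (+ k) *P powP (X- k) (length S₀)
          *P prodP (map (λ S → r (toList S)) (S₀ ++ Sn ∷ [])))
     +P prodP (map (λ S → r (toList S ++ k ∷ [])) (S₀ ++ Sn ∷ [])))

module Submission where

-- Proper q-colourings are counted by colouring the vertices one at a time (`Sequential`);
-- for a symmetric adjacency this count equals `numColourings` and does not depend on the
-- order of the vertices (`Symmetric`). We colour the apex first (colour a, q choices),
-- then the final k-clique, then the clique paths. Colouring a clique amounts to an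
-- injective choice of colours (`InjectiveChoices`, `Cliques`); when the rest depends only
-- on whether a special colour is used, such sums have closed forms (`injSum-settled`,
-- `injSum-special`). Given the colours of the apex and the final clique the paths are
-- independent, and each path is counted block by block from the final clique towards the
-- apex (`path-count`), giving the explicit recursion `pathCount`. Finally `pathCount` is
-- solved in closed form in terms of r(1, …; X) (`pathCount-closed`), the right-hand side
-- is evaluated factor by factor (`Evaluation`), and the two agree for q > 0; at q = 0
-- both sides vanish.

open import Defs
open import Data.Bool using (Bool; true; false; _∧_; _∨_; not; T)
import Data.Bool as Bool
import Data.Bool.Properties as BP
open import Data.Nat as ℕ using (ℕ; zero; suc; _≡ᵇ_; _≤_; _<_; _∸_; z≤n; s≤s)
import Data.Nat.Properties as NP
open import Data.Integer using (ℤ; +_; -_; _+_; _*_; _-_; _^_; 0ℤ; 1ℤ)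
import Data.Integer.Properties as ZP
open import Data.Integer.Tactic.RingSolver using (solve-∀)
open import Data.List using (List; _∷_; []; _++_; map; concatMap; filter; length; foldr; zip; applyUpTo; upTo; reverse; initLast; _∷ʳ′_)
import Data.List.Properties as LP
open import Data.List.NonEmpty using (List⁺; _∷_; toList; last)
open import Data.List.Relation.Unary.All as All using (All; []; _∷_)
import Data.List.Relation.Unary.All.Properties as AllP
open import Data.List.Relation.Unary.AllPairs using (AllPairs; []; _∷_)
open import Data.List.Relation.Unary.Unique.Propositional using (Unique)
open import Data.List.Relation.Unary.Unique.Propositional.Properties using (upTo⁺)
open import Data.List.Relation.Binary.Permutation.Propositional using (_↭_; refl; prep; swap; trans; ↭-refl; ↭-sym; ↭-trans)
import Data.List.Relation.Binary.Permutation.Propositional.Properties as PermP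
open import Data.Product using (_×_; _,_; proj₁; proj₂; Σ)
open import Data.Unit using (⊤; tt)
open import Data.Empty using (⊥; ⊥-elim)
open import Relation.Nullary using (¬_)
open import Relation.Binary.PropositionalEquality as Eq using (_≡_; cong; cong₂; sym; subst)
open Eq.≡-Reasoning

≡ᵇ-sym : ∀ a b → (a ≡ᵇ b) ≡ (b ≡ᵇ a)
≡ᵇ-sym zero    zero    = Eq.refl
≡ᵇ-sym zero    (suc b) = Eq.refl
≡ᵇ-sym (suc a) zero    = Eq.refl
≡ᵇ-sym (suc a) (suc b) = ≡ᵇ-sym a b

≡ᵇ-refl : ∀ n → (n ≡ᵇ n) ≡ true
≡ᵇ-refl zero    = Eq.refl
≡ᵇ-refl (suc n) = ≡ᵇ-refl n

≡ᵇ⇒≡ : ∀ {x y} → (x ≡ᵇ y) ≡ true → x ≡ y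
≡ᵇ⇒≡ {x} {y} e = NP.≡ᵇ⇒≡ x y (subst T (sym e) tt)

≢⇒≡ᵇ-false : ∀ {x y} → ¬ x ≡ y → (x ≡ᵇ y) ≡ false
≢⇒≡ᵇ-false {x} {y} x≢y with x ≡ᵇ y in e
... | false = Eq.refl
... | true  = ⊥-elim (x≢y (≡ᵇ⇒≡ e))

<⇒≡ᵇ-false : ∀ {x y} → x < y → (x ≡ᵇ y) ≡ false
<⇒≡ᵇ-false x<y = ≢⇒≡ᵇ-false (λ e → NP.<-irrefl e x<y)

>⇒≡ᵇ-false : ∀ {x y} → x < y → (y ≡ᵇ x) ≡ false
>⇒≡ᵇ-false x<y = ≢⇒≡ᵇ-false (λ e → NP.<-irrefl (sym e) x<y)

false≢true : ¬ false ≡ true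
false≢true ()

∧-true₁ : ∀ {u v} → u ∧ v ≡ true → u ≡ true
∧-true₁ {true} _ = Eq.refl

not-true : ∀ {u} → not u ≡ true → u ≡ false
not-true {false} _ = Eq.refl

∧-interchange : ∀ a b c d → (a ∧ b) ∧ (c ∧ d) ≡ (a ∧ c) ∧ (b ∧ d)
∧-interchange true  true  c d = Eq.refl
∧-interchange true  false c d = sym (BP.∧-zeroʳ c)
∧-interchange false b     c d = Eq.refl

∧-swap₃ : ∀ a b c → (a ∧ b) ∧ c ≡ (a ∧ c) ∧ b
∧-swap₃ true  b c = BP.∧-comm b c
∧-swap₃ false b c = Eq.refl

not-∨-∧ : ∀ u v w → u ∧ not (v ∨ w) ≡ (u ∧ not w) ∧ not v
not-∨-∧ u     true  w = Eq.trans (BP.∧-zeroʳ u) (sym (BP.∧-zeroʳ (u ∧ not w)))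
not-∨-∧ u     false w = sym (BP.∧-identityʳ (u ∧ not w))

when : Bool → ℤ → ℤ
when true  x = x
when false x = 0ℤ

Σ< : ℕ → (ℕ → ℤ) → ℤ
Σ< zero    f = 0ℤ
Σ< (suc n) f = f 0 + Σ< n (λ x → f (suc x))

Σ<-cong : ∀ n {f g : ℕ → ℤ} → (∀ x → x < n → f x ≡ g x) → Σ< n f ≡ Σ< n g
Σ<-cong zero    h = Eq.refl
Σ<-cong (suc n) h = cong₂ _+_ (h 0 (s≤s z≤n)) (Σ<-cong n (λ x x<n → h (suc x) (s≤s x<n)))

Σ<-zero : ∀ n → Σ< n (λ _ → 0ℤ) ≡ 0ℤ
Σ<-zero zero    = Eq.refl
Σ<-zero (suc n) = Eq.trans (ZP.+-identityˡ _) (Σ<-zero n)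

Σ<-+ : ∀ n (f g : ℕ → ℤ) → Σ< n (λ x → f x + g x) ≡ Σ< n f + Σ< n g
Σ<-+ zero    f g = Eq.refl
Σ<-+ (suc n) f g = Eq.trans (cong (λ z → (f 0 + g 0) + z) (Σ<-+ n _ _)) (interchange (f 0) (g 0) _ _)
  where interchange : ∀ a b c d → (a + b) + (c + d) ≡ (a + c) + (b + d)
        interchange = solve-∀

Σ<-*ʳ : ∀ n (f : ℕ → ℤ) b → Σ< n (λ x → f x * b) ≡ Σ< n f * b
Σ<-*ʳ zero    f b = Eq.refl
Σ<-*ʳ (suc n) f b = Eq.trans (cong (λ z → f 0 * b + z) (Σ<-*ʳ n _ b)) (sym (ZP.*-distribʳ-+ b (f 0) _))

Σ<-swap : ∀ n m (F : ℕ → ℕ → ℤ) → Σ< n (λ c → Σ< m (F c)) ≡ Σ< m (λ d → Σ< n (λ c → F c d))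
Σ<-swap zero    m F = sym (Σ<-zero m)
Σ<-swap (suc n) m F =
  Eq.trans (cong (λ z → Σ< m (F 0) + z) (Σ<-swap n m (λ c → F (suc c))))
           (sym (Σ<-+ m (F 0) (λ d → Σ< n (λ c → F (suc c) d))))

Σ<-single : ∀ n c (F : ℕ → ℤ) → c < n → Σ< n (λ x → when (x ≡ᵇ c) (F x)) ≡ F c
Σ<-single (suc n) zero    F _ = Eq.trans (cong (λ z → F 0 + z) (Σ<-zero n)) (ZP.+-identityʳ _)
Σ<-single (suc n) (suc c) F (s≤s c<n) = Eq.trans (ZP.+-identityˡ _) (Σ<-single n c (λ x → F (suc x)) c<n)

when-Σ< : ∀ b n (f : ℕ → ℤ) → when b (Σ< n f) ≡ Σ< n (λ x → when b (f x))
when-Σ< true  n f = Eq.refl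
when-Σ< false n f = sym (Σ<-zero n)

when-* : ∀ b x y → when b (x * y) ≡ when b x * y
when-* true  x y = Eq.refl
when-* false x y = Eq.refl

when-+ : ∀ b x y → when b (x + y) ≡ when b x + when b y
when-+ true  x y = Eq.refl
when-+ false x y = Eq.refl

when-comm : ∀ u v (x : ℤ) → when u (when v x) ≡ when v (when u x)
when-comm true  true  x = Eq.refl
when-comm true  false x = Eq.refl
when-comm false true  x = Eq.refl
when-comm false false x = Eq.refl

when-exchange : ∀ a b n (x : ℤ) → when a (when (b ∧ n) x) ≡ when b (when (a ∧ n) x)
when-exchange true  true  n x = Eq.refl
when-exchange true  false n x = Eq.refl
when-exchange false true  n x = Eq.refl
when-exchange false false n x = Eq.refl

when-cond : ∀ b (x y : ℤ) → (b ≡ true → x ≡ y) → when b x ≡ when b y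
when-cond true  x y h = h Eq.refl
when-cond false x y h = Eq.refl

count : ℕ → (ℕ → Bool) → ℤ
count q p = Σ< q (λ c → when (p c) 1ℤ)

count-cong : ∀ q {p p′ : ℕ → Bool} → (∀ x → p x ≡ p′ x) → count q p ≡ count q p′
count-cong q h = Σ<-cong q (λ x _ → cong (λ b → when b 1ℤ) (h x))

count-all : ∀ q → count q (λ _ → true) ≡ + q
count-all zero    = Eq.refl
count-all (suc q) = cong (λ z → 1ℤ + z) (count-all q)

Σ<-const : ∀ q (p : ℕ → Bool) K → Σ< q (λ c → when (p c) K) ≡ count q p * K
Σ<-const q p K = Eq.trans (Σ<-cong q (λ c _ → scale (p c))) (Σ<-*ʳ q _ K)
  where scale : ∀ b → when b K ≡ when b 1ℤ * K
        scale true  = sym (ZP.*-identityˡ K)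
        scale false = Eq.refl

infix 8 _↓_
_↓_ : ℤ → ℕ → ℤ
x ↓ zero  = 1ℤ
x ↓ suc d = x * (x - 1ℤ) ↓ d

↓-last : ∀ x n → x ↓ suc n ≡ x ↓ n * (x - + n)
↓-last x zero    = lem x
  where lem : ∀ x → x * 1ℤ ≡ 1ℤ * (x - 0ℤ)
        lem = solve-∀
↓-last x (suc n) = Eq.trans (cong (x *_) (↓-last (x - 1ℤ) n)) (lem x ((x - 1ℤ) ↓ n) (+ n))
  where lem : ∀ x y m → x * (y * ((x - 1ℤ) - m)) ≡ (x * y) * (x - (1ℤ + m))
        lem = solve-∀

↓-+ : ∀ x m n → x ↓ (m ℕ.+ n) ≡ x ↓ m * (x - + m) ↓ n
↓-+ x zero    n = Eq.trans (cong (_↓ n) (lem x)) (sym (ZP.*-identityˡ _))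
  where lem : ∀ x → x ≡ x - 0ℤ
        lem = solve-∀
↓-+ x (suc m) n =
  Eq.trans (cong (x *_) (↓-+ (x - 1ℤ) m n))
  (Eq.trans (sym (ZP.*-assoc x _ _)) (cong (λ z → x * (x - 1ℤ) ↓ m * z ↓ n) (lem x (+ m))))
  where lem : ∀ x m → (x - 1ℤ) - m ≡ x - (1ℤ + m)
        lem = solve-∀

↓-absorb : ∀ x d → x * (+ d * (x - 1ℤ) ↓ (d ∸ 1)) ≡ + d * x ↓ d
↓-absorb x zero    = ZP.*-zeroʳ x
↓-absorb x (suc d) = lem x (+ suc d) ((x - 1ℤ) ↓ d)
  where lem : ∀ x y z → x * (y * z) ≡ y * (x * z)
        lem = solve-∀

prodZ : {A : Set} → (A → ℤ) → List A → ℤ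
prodZ f []       = 1ℤ
prodZ f (x ∷ xs) = f x * prodZ f xs

prodZ-cong : ∀ {A : Set} {P : A → Set} {f g : A → ℤ} xs → All P xs →
             (∀ x → P x → f x ≡ g x) → prodZ f xs ≡ prodZ g xs
prodZ-cong []       []       h = Eq.refl
prodZ-cong (x ∷ xs) (p ∷ ps) h = cong₂ _*_ (h x p) (prodZ-cong xs ps h)

prodZ-cong′ : ∀ {A : Set} {f g : A → ℤ} xs → (∀ x → f x ≡ g x) → prodZ f xs ≡ prodZ g xs
prodZ-cong′ xs h = prodZ-cong {P = λ _ → ⊤} xs (All.universal (λ _ → tt) xs) (λ x _ → h x)

prodZ-++ : ∀ {A : Set} (f : A → ℤ) xs ys → prodZ f (xs ++ ys) ≡ prodZ f xs * prodZ f ys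
prodZ-++ f []       ys = sym (ZP.*-identityˡ _)
prodZ-++ f (x ∷ xs) ys = Eq.trans (cong (f x *_) (prodZ-++ f xs ys)) (sym (ZP.*-assoc (f x) _ _))

prodZ-reverse : ∀ {A : Set} (f : A → ℤ) xs → prodZ f (reverse xs) ≡ prodZ f xs
prodZ-reverse f []       = Eq.refl
prodZ-reverse f (x ∷ xs) = begin
  prodZ f (reverse (x ∷ xs))          ≡⟨ cong (prodZ f) (LP.unfold-reverse x xs) ⟩
  prodZ f (reverse xs ++ x ∷ [])      ≡⟨ prodZ-++ f (reverse xs) (x ∷ []) ⟩
  prodZ f (reverse xs) * (f x * 1ℤ)   ≡⟨ cong₂ _*_ (prodZ-reverse f xs) (ZP.*-identityʳ (f x)) ⟩
  prodZ f xs * f x                    ≡⟨ ZP.*-comm _ (f x) ⟩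
  prodZ f (x ∷ xs)                    ∎

prodZ-* : ∀ {A : Set} (f g : A → ℤ) xs → prodZ (λ x → f x * g x) xs ≡ prodZ f xs * prodZ g xs
prodZ-* f g []       = Eq.refl
prodZ-* f g (x ∷ xs) = Eq.trans (cong (f x * g x *_) (prodZ-* f g xs)) (lem (f x) (g x) _ _)
  where lem : ∀ a b c d → a * b * (c * d) ≡ a * c * (b * d)
        lem = solve-∀

prodZ-const : ∀ {A : Set} c (xs : List A) → prodZ (λ _ → c) xs ≡ c ^ length xs
prodZ-const c []       = Eq.refl
prodZ-const c (x ∷ xs) = cong (c *_) (prodZ-const c xs)

prodZ-*₃ : ∀ {A : Set} (f g h : A → ℤ) xs → prodZ (λ S → (f S * g S) * h S) xs ≡ prodZ f xs * prodZ g xs * prodZ h xs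
prodZ-*₃ f g h xs = Eq.trans (prodZ-* (λ S → f S * g S) h xs) (cong (_* prodZ h xs) (prodZ-* f g xs))

prodZ-scale : ∀ {A : Set} c (u : A → ℤ) xs → prodZ (λ S → c * u S) xs ≡ c ^ length xs * prodZ u xs
prodZ-scale c u xs = Eq.trans (prodZ-* (λ _ → c) u xs) (cong (_* prodZ u xs) (prodZ-const c xs))

evalP-+ : ∀ p q x → evalP (p +P q) x ≡ evalP p x + evalP q x
evalP-+ []      q       x = sym (ZP.+-identityˡ _)
evalP-+ (a ∷ p) []      x = sym (ZP.+-identityʳ _)
evalP-+ (a ∷ p) (b ∷ q) x =
  Eq.trans (cong (λ z → (a + b) + x * z) (evalP-+ p q x)) (lem a b x (evalP p x) (evalP q x))
  where lem : ∀ a b x u v → (a + b) + x * (u + v) ≡ (a + x * u) + (b + x * v)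
        lem = solve-∀

evalP-scale : ∀ c p x → evalP (scaleP c p) x ≡ c * evalP p x
evalP-scale c []      x = sym (ZP.*-zeroʳ c)
evalP-scale c (a ∷ p) x = Eq.trans (cong (λ z → c * a + x * z) (evalP-scale c p x)) (lem c a x (evalP p x))
  where lem : ∀ c a x u → c * a + x * (c * u) ≡ c * (a + x * u)
        lem = solve-∀

evalP-neg : ∀ p x → evalP (negP p) x ≡ - evalP p x
evalP-neg []      x = Eq.refl
evalP-neg (a ∷ p) x = Eq.trans (cong (λ z → - a + x * z) (evalP-neg p x)) (lem a x (evalP p x))
  where lem : ∀ a x u → - a + x * (- u) ≡ - (a + x * u)
        lem = solve-∀

evalP-- : ∀ p q x → evalP (p -P q) x ≡ evalP p x - evalP q x
evalP-- p q x = Eq.trans (evalP-+ p (negP q) x) (cong (λ z → evalP p x + z) (evalP-neg q x))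

evalP-* : ∀ p q x → evalP (p *P q) x ≡ evalP p x * evalP q x
evalP-* []      q x = Eq.refl
evalP-* (a ∷ p) q x = begin
  evalP (scaleP a q +P (+ 0 ∷ (p *P q))) x        ≡⟨ evalP-+ (scaleP a q) (+ 0 ∷ (p *P q)) x ⟩
  evalP (scaleP a q) x + (+ 0 + x * evalP (p *P q) x)
    ≡⟨ cong₂ (λ u v → u + (+ 0 + x * v)) (evalP-scale a q x) (evalP-* p q x) ⟩
  a * evalP q x + (+ 0 + x * (evalP p x * evalP q x)) ≡⟨ lem a x (evalP p x) (evalP q x) ⟩
  (a + x * evalP p x) * evalP q x                 ∎
  where lem : ∀ a x u v → a * v + (+ 0 + x * (u * v)) ≡ (a + x * u) * v
        lem = solve-∀

evalP-const : ∀ c x → evalP (constP c) x ≡ c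
evalP-const c x = Eq.trans (cong (λ z → c + z) (ZP.*-zeroʳ x)) (ZP.+-identityʳ c)

evalP-X- : ∀ c x → evalP (X- c) x ≡ x - + c
evalP-X- c x = Eq.trans (evalP-- Xp (constP (+ c)) x) (cong₂ _-_ (lem x) (evalP-const (+ c) x))
  where lem : ∀ x → + 0 + x * (+ 1 + x * + 0) ≡ x
        lem = solve-∀

evalP-prod : ∀ {A : Set} (f : A → Poly) xs x → evalP (prodP (map f xs)) x ≡ prodZ (λ y → evalP (f y) x) xs
evalP-prod f []       x = evalP-const (+ 1) x
evalP-prod f (y ∷ ys) x = Eq.trans (evalP-* (f y) (prodP (map f ys)) x) (cong (evalP (f y) x *_) (evalP-prod f ys x))

evalP-pow : ∀ p n x → evalP (powP p n) x ≡ evalP p x ^ n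
evalP-pow p zero    x = evalP-const (+ 1) x
evalP-pow p (suc n) x = Eq.trans (evalP-* p (powP p n) x) (cong (evalP p x *_) (evalP-pow p n x))

evalP-fall : ∀ c j x → evalP (fall c j) x ≡ (x - + c) ↓ j
evalP-fall c zero    x = evalP-const (+ 1) x
evalP-fall c (suc j) x =
  Eq.trans (evalP-* (X- c) (fall (suc c) j) x)
           (cong₂ _*_ (evalP-X- c x) (Eq.trans (evalP-fall (suc c) j x) (cong (_↓ j) (lem x (+ c)))))
  where lem : ∀ x c → x - (1ℤ + c) ≡ (x - c) - 1ℤ
        lem = solve-∀

evalP-fall-0 : ∀ j x → evalP (fall 0 j) x ≡ x ↓ j
evalP-fall-0 j x = Eq.trans (evalP-fall 0 j x) (cong (_↓ j) (ZP.+-identityʳ x))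

evalP-fall-suc : ∀ c j x → evalP (fall (suc c) j) x ≡ ((x - + c) - 1ℤ) ↓ j
evalP-fall-suc c j x = Eq.trans (evalP-fall (suc c) j x) (cong (_↓ j) (lem x (+ c)))
  where lem : ∀ x c → x - (1ℤ + c) ≡ (x - c) - 1ℤ
        lem = solve-∀

evalP-divX : ∀ p x → evalP p x ≡ evalP p 0ℤ + x * evalP (divX p) x
evalP-divX []      x = sym (Eq.trans (ZP.+-identityˡ _) (ZP.*-zeroʳ x))
evalP-divX (a ∷ p) x =
  cong (_+ x * evalP p x) (sym (Eq.trans (cong (λ z → a + z) (ZP.*-zeroˡ (evalP p 0ℤ))) (ZP.+-identityʳ a)))

-- The two products in the definition of r(1, b₁, …, bₜ; X), evaluated at x.
linProd : ℤ → List ℕ → ℤ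
linProd x = prodZ (λ b → x - + b)

negProd : List ℕ → ℤ
negProd = prodZ (λ b → - + b)

-- x · r(1, bs; x) = ∏ (x - bᵢ) - ∏ (-bᵢ): the numerator has no constant term.
evalP-r : ∀ bs x → x * evalP (r bs) x ≡ linProd x bs - negProd bs
evalP-r bs x = begin
  x * evalP (r bs) x                  ≡⟨ sym (ZP.+-identityˡ _) ⟩
  0ℤ + x * evalP (divX N) x           ≡⟨ cong (_+ x * evalP (divX N) x) (sym numerator-at-0) ⟩
  evalP N 0ℤ + x * evalP (divX N) x   ≡⟨ sym (evalP-divX N x) ⟩
  evalP N x                           ≡⟨ numerator x ⟩
  linProd x bs - negProd bs           ∎
  where
  N : Poly
  N = prodP (map X-_ bs) -P constP (foldr (λ b acc → (- (+ b)) * acc) (+ 1) bs)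
  fold≡negProd : ∀ bs → foldr (λ b acc → (- (+ b)) * acc) (+ 1) bs ≡ negProd bs
  fold≡negProd []       = Eq.refl
  fold≡negProd (b ∷ bs) = cong ((- (+ b)) *_) (fold≡negProd bs)
  numerator : ∀ y → evalP N y ≡ linProd y bs - negProd bs
  numerator y = Eq.trans (evalP-- (prodP (map X-_ bs)) _ y)
    (cong₂ _-_ (Eq.trans (evalP-prod X-_ bs y) (prodZ-cong′ bs (λ b → evalP-X- b y)))
               (Eq.trans (evalP-const _ y) (fold≡negProd bs)))
  numerator-at-0 : evalP N 0ℤ ≡ 0ℤ
  numerator-at-0 = Eq.trans (numerator 0ℤ)
    (Eq.trans (cong (_- negProd bs) (prodZ-cong′ bs (λ b → ZP.+-identityˡ (- (+ b)))))
              (ZP.+-inverseʳ (negProd bs)))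

-- r(1, b₁, …, bₜ; x) computed from the last entry backwards: with bs = (bₜ, …, b₁),
-- r(…, bₜ) = (x - bₜ) · r(…, bₜ₋₁) + ∏_{i<t} (-bᵢ).
rRev : ℤ → List ℕ → ℤ
rRev x []       = 0ℤ
rRev x (b ∷ bs) = (x - + b) * rRev x bs + negProd bs

rRev-numerator : ∀ x bs → x * rRev x bs ≡ linProd x bs - negProd bs
rRev-numerator x []       = Eq.trans (ZP.*-zeroʳ x) (sym (ZP.+-inverseʳ 1ℤ))
rRev-numerator x (b ∷ bs) = begin
  x * ((x - + b) * rRev x bs + negProd bs)             ≡⟨ lem₁ x (x - + b) (rRev x bs) (negProd bs) ⟩
  (x - + b) * (x * rRev x bs) + x * negProd bs
    ≡⟨ cong (λ z → (x - + b) * z + x * negProd bs) (rRev-numerator x bs) ⟩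
  (x - + b) * (linProd x bs - negProd bs) + x * negProd bs ≡⟨ lem₂ x (+ b) (linProd x bs) (negProd bs) ⟩
  linProd x (b ∷ bs) - negProd (b ∷ bs)                 ∎
  where lem₁ : ∀ x y r c → x * (y * r + c) ≡ y * (x * r) + x * c
        lem₁ = solve-∀
        lem₂ : ∀ x b p c → (x - b) * (p - c) + x * c ≡ (x - b) * p - (- b) * c
        lem₂ = solve-∀

-- At a positive integer both sides agree after multiplication by x ≠ 0.
evalP-r-rRev : ∀ bs n → evalP (r bs) (+ suc n) ≡ rRev (+ suc n) (reverse bs)
evalP-r-rRev bs n = ZP.*-cancelˡ-≡ x _ _ (begin
  x * evalP (r bs) x                           ≡⟨ evalP-r bs x ⟩
  linProd x bs - negProd bs                    ≡⟨ sym (cong₂ _-_ (prodZ-reverse _ bs) (prodZ-reverse _ bs)) ⟩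
  linProd x (reverse bs) - negProd (reverse bs) ≡⟨ sym (rRev-numerator x (reverse bs)) ⟩
  x * rRev x (reverse bs)                      ∎)
  where x = + suc n

-- Colour the vertices of a list one at a time; a constraint
-- φ w d says that colour d is still allowed at w. Choosing colour c at v forbids c
-- at the neighbours of v. `cnt vs φ` is the number of proper q-colourings of vs
-- respecting φ.
module Sequential {V : Set} (adj : V → V → Bool) (q : ℕ) where

  Constraint : Set
  Constraint = V → ℕ → Bool

  forbid : V → ℕ → Constraint → Constraint
  forbid v c φ w d = φ w d ∧ not (adj w v ∧ (d ≡ᵇ c))

  cnt : List V → Constraint → ℤ
  cnt []       φ = 1ℤ
  cnt (v ∷ vs) φ = Σ< q (λ c → when (φ v c) (cnt vs (forbid v c φ)))

  cnt-cong : ∀ vs (φ ψ : Constraint) → All (λ w → ∀ d → φ w d ≡ ψ w d) vs → cnt vs φ ≡ cnt vs ψ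
  cnt-cong []       φ ψ h          = Eq.refl
  cnt-cong (v ∷ vs) φ ψ (hv ∷ hvs) = Σ<-cong q (λ c _ → cong₂ when (hv c) (cnt-cong vs _ _ (forbid-cong hvs)))
    where
    forbid-cong : ∀ {ws c} → All (λ w → ∀ d → φ w d ≡ ψ w d) ws →
                  All (λ w → ∀ d → forbid v c φ w d ≡ forbid v c ψ w d) ws
    forbid-cong = All.map (λ h d → cong (_∧ _) (h d))

  NoEdges : List V → List V → Set
  NoEdges xs ys = All (λ x → All (λ y → adj y x ≡ false) ys) xs

  cnt-++-independent : ∀ xs ys φ → NoEdges xs ys → cnt (xs ++ ys) φ ≡ cnt xs φ * cnt ys φ
  cnt-++-independent []       ys φ h          = sym (ZP.*-identityˡ _)
  cnt-++-independent (x ∷ xs) ys φ (hx ∷ hxs) =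
    Eq.trans (Σ<-cong q (λ c _ → begin
        when (φ x c) (cnt (xs ++ ys) (forbid x c φ))
          ≡⟨ cong (when (φ x c)) (cnt-++-independent xs ys _ hxs) ⟩
        when (φ x c) (cnt xs (forbid x c φ) * cnt ys (forbid x c φ))
          ≡⟨ cong (λ z → when (φ x c) (cnt xs (forbid x c φ) * z)) (cnt-cong ys _ _ (untouched hx)) ⟩
        when (φ x c) (cnt xs (forbid x c φ) * cnt ys φ)
          ≡⟨ when-* (φ x c) _ _ ⟩
        when (φ x c) (cnt xs (forbid x c φ)) * cnt ys φ ∎))
      (Σ<-*ʳ q _ _)
    where
    untouched : ∀ {zs c} → All (λ y → adj y x ≡ false) zs → All (λ w → ∀ d → forbid x c φ w d ≡ φ w d) zs
    untouched = All.map (λ h d → Eq.trans (cong (λ z → _ ∧ not (z ∧ _)) h) (BP.∧-identityʳ _))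

countWhere : (List ℕ → Bool) → List (List ℕ) → ℤ
countWhere P []       = 0ℤ
countWhere P (x ∷ xs) = when (P x) 1ℤ + countWhere P xs

length-filter : ∀ (P : List ℕ → Bool) L → + length (filter (λ f → P f Bool.≟ true) L) ≡ countWhere P L
length-filter P []       = Eq.refl
length-filter P (x ∷ xs) with P x
... | true  = cong (λ z → 1ℤ + z) (length-filter P xs)
... | false = Eq.trans (length-filter P xs) (sym (ZP.+-identityˡ _))

countWhere-++ : ∀ P xs ys → countWhere P (xs ++ ys) ≡ countWhere P xs + countWhere P ys
countWhere-++ P []       ys = sym (ZP.+-identityˡ _)
countWhere-++ P (x ∷ xs) ys =
  Eq.trans (cong (λ z → when (P x) 1ℤ + z) (countWhere-++ P xs ys)) (sym (ZP.+-assoc (when (P x) 1ℤ) _ _))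

countWhere-map : ∀ P (f : List ℕ → List ℕ) L → countWhere P (map f L) ≡ countWhere (λ x → P (f x)) L
countWhere-map P f []      = Eq.refl
countWhere-map P f (x ∷ L) = cong (λ z → when (P (f x)) 1ℤ + z) (countWhere-map P f L)

countWhere-cong : ∀ {P Q} L → (∀ x → P x ≡ Q x) → countWhere P L ≡ countWhere Q L
countWhere-cong []      h = Eq.refl
countWhere-cong (x ∷ L) h = cong₂ (λ a z → when a 1ℤ + z) (h x) (countWhere-cong L h)

countWhere-∧ : ∀ b P L → countWhere (λ x → b ∧ P x) L ≡ when b (countWhere P L)
countWhere-∧ true  P L       = Eq.refl
countWhere-∧ false P []      = Eq.refl
countWhere-∧ false P (x ∷ L) = Eq.trans (ZP.+-identityˡ _) (countWhere-∧ false P L)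

countWhere-first : ∀ P M n → countWhere P (concatMap (λ c → map (c ∷_) M) (applyUpTo (λ x → x) n))
                             ≡ Σ< n (λ c → countWhere (λ cs → P (c ∷ cs)) M)
countWhere-first P M n = go (λ x → x) n
  where
  go : ∀ (g : ℕ → ℕ) n → countWhere P (concatMap (λ c → map (c ∷_) M) (applyUpTo g n))
                         ≡ Σ< n (λ c → countWhere (λ cs → P (g c ∷ cs)) M)
  go g zero    = Eq.refl
  go g (suc n) = Eq.trans (countWhere-++ P (map (g 0 ∷_) M) _)
                          (cong₂ _+_ (countWhere-map P (g 0 ∷_) M) (go (λ x → g (suc x)) n))

-- For a symmetric adjacency, sequential counting computes the number of proper
-- colourings and does not depend on the order in which the vertices are listed.
module Symmetric {V : Set} (adj : V → V → Bool) (adjSym : ∀ x y → adj x y ≡ adj y x) (q : ℕ) where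
  open Sequential adj q

  respects : List V → List ℕ → Constraint → Bool
  respects (v ∷ vs) (c ∷ cs) φ = φ v c ∧ respects vs cs φ
  respects _        _        φ = true

  clashFree : V → ℕ → List V → List ℕ → Bool
  clashFree v c (w ∷ ws) (d ∷ ds) = not (adj v w ∧ (c ≡ᵇ d)) ∧ clashFree v c ws ds
  clashFree v c _        _        = true

  properᵇ-∷ : ∀ v c vs cs → properᵇ adj (v ∷ vs) (c ∷ cs) ≡ clashFree v c vs cs ∧ properᵇ adj vs cs
  properᵇ-∷ v c vs cs = cong (_∧ properᵇ adj vs cs) (fold vs cs)
    where
    fold : ∀ ws ds → foldr _∧_ true (map (λ { (w , d) → not (adj v w ∧ (c ≡ᵇ d)) }) (zip ws ds))
                     ≡ clashFree v c ws ds
    fold (w ∷ ws) (d ∷ ds) = cong (_ ∧_) (fold ws ds)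
    fold []       ds       = Eq.refl
    fold (w ∷ ws) []       = Eq.refl

  -- By symmetry, forbidding c next to v means not clashing with v coloured c.
  respects-forbid : ∀ v c φ vs cs → respects vs cs (forbid v c φ) ≡ respects vs cs φ ∧ clashFree v c vs cs
  respects-forbid v c φ (w ∷ ws) (d ∷ ds) = begin
    (φ w d ∧ not (adj w v ∧ (d ≡ᵇ c))) ∧ respects ws ds (forbid v c φ)
      ≡⟨ cong₂ (λ x y → (φ w d ∧ not (x ∧ y)) ∧ respects ws ds (forbid v c φ)) (adjSym w v) (≡ᵇ-sym d c) ⟩
    (φ w d ∧ not (adj v w ∧ (c ≡ᵇ d))) ∧ respects ws ds (forbid v c φ)
      ≡⟨ cong (_ ∧_) (respects-forbid v c φ ws ds) ⟩
    (φ w d ∧ not (adj v w ∧ (c ≡ᵇ d))) ∧ (respects ws ds φ ∧ clashFree v c ws ds)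
      ≡⟨ ∧-interchange (φ w d) _ _ _ ⟩
    (φ w d ∧ respects ws ds φ) ∧ (not (adj v w ∧ (c ≡ᵇ d)) ∧ clashFree v c ws ds) ∎
  respects-forbid v c φ []       cs = Eq.refl
  respects-forbid v c φ (w ∷ ws) [] = Eq.refl

  cnt-counts : ∀ vs φ → countWhere (λ cs → properᵇ adj vs cs ∧ respects vs cs φ) (colourings q (length vs))
                        ≡ cnt vs φ
  cnt-counts []       φ = Eq.refl
  cnt-counts (v ∷ vs) φ =
    Eq.trans (countWhere-first _ (colourings q (length vs)) q)
      (Σ<-cong q (λ c _ → begin
        countWhere (λ cs → properᵇ adj (v ∷ vs) (c ∷ cs) ∧ (φ v c ∧ respects vs cs φ)) words
          ≡⟨ countWhere-cong words (λ cs → regroup c cs) ⟩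
        countWhere (λ cs → φ v c ∧ (properᵇ adj vs cs ∧ respects vs cs (forbid v c φ))) words
          ≡⟨ countWhere-∧ (φ v c) _ words ⟩
        when (φ v c) (countWhere (λ cs → properᵇ adj vs cs ∧ respects vs cs (forbid v c φ)) words)
          ≡⟨ cong (when (φ v c)) (cnt-counts vs (forbid v c φ)) ⟩
        when (φ v c) (cnt vs (forbid v c φ)) ∎))
    where
    words = colourings q (length vs)
    shuffle : ∀ F P f C → (F ∧ P) ∧ (f ∧ C) ≡ f ∧ (P ∧ (C ∧ F))
    shuffle true  P     true  C     = cong (P ∧_) (sym (BP.∧-identityʳ C))
    shuffle true  P     false C     = BP.∧-zeroʳ P
    shuffle false P     false C     = Eq.refl
    shuffle false false true  C     = Eq.refl
    shuffle false true  true  true  = Eq.refl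
    shuffle false true  true  false = Eq.refl
    regroup : ∀ c cs → properᵇ adj (v ∷ vs) (c ∷ cs) ∧ (φ v c ∧ respects vs cs φ)
                       ≡ φ v c ∧ (properᵇ adj vs cs ∧ respects vs cs (forbid v c φ))
    regroup c cs = Eq.trans (cong (_∧ (φ v c ∧ respects vs cs φ)) (properᵇ-∷ v c vs cs))
      (Eq.trans (shuffle (clashFree v c vs cs) (properᵇ adj vs cs) (φ v c) (respects vs cs φ))
        (cong (λ z → φ v c ∧ (properᵇ adj vs cs ∧ z)) (sym (respects-forbid v c φ vs cs))))

  cnt-swap : ∀ u w vs φ → cnt (u ∷ w ∷ vs) φ ≡ cnt (w ∷ u ∷ vs) φ
  cnt-swap u w vs φ = begin
    Σ< q (λ c → when (φ u c) (Σ< q (λ d → when (forbid u c φ w d) (rest c d))))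
      ≡⟨ Σ<-cong q (λ c _ → when-Σ< (φ u c) q _) ⟩
    Σ< q (λ c → Σ< q (λ d → when (φ u c) (when (forbid u c φ w d) (rest c d))))
      ≡⟨ Σ<-swap q q _ ⟩
    Σ< q (λ d → Σ< q (λ c → when (φ u c) (when (forbid u c φ w d) (rest c d))))
      ≡⟨ Σ<-cong q (λ d _ → Σ<-cong q (λ c _ → exchange c d)) ⟩
    Σ< q (λ d → Σ< q (λ c → when (φ w d) (when (forbid w d φ u c) (rest′ c d))))
      ≡⟨ Σ<-cong q (λ d _ → sym (when-Σ< (φ w d) q _)) ⟩
    Σ< q (λ d → when (φ w d) (Σ< q (λ c → when (forbid w d φ u c) (rest′ c d)))) ∎
    where
    rest rest′ : ℕ → ℕ → ℤ
    rest  c d = cnt vs (forbid w d (forbid u c φ))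
    rest′ c d = cnt vs (forbid u c (forbid w d φ))
    exchange : ∀ c d → when (φ u c) (when (forbid u c φ w d) (rest c d))
                       ≡ when (φ w d) (when (forbid w d φ u c) (rest′ c d))
    exchange c d = begin
      when (φ u c) (when (φ w d ∧ not (adj w u ∧ (d ≡ᵇ c))) (rest c d))
        ≡⟨ cong₂ (λ x y → when (φ u c) (when (φ w d ∧ not (x ∧ y)) (rest c d))) (adjSym w u) (≡ᵇ-sym d c) ⟩
      when (φ u c) (when (φ w d ∧ not (adj u w ∧ (c ≡ᵇ d))) (rest c d))
        ≡⟨ when-exchange (φ u c) (φ w d) _ _ ⟩
      when (φ w d) (when (φ u c ∧ not (adj u w ∧ (c ≡ᵇ d))) (rest c d))
        ≡⟨ cong (λ z → when (φ w d) (when (φ u c ∧ not (adj u w ∧ (c ≡ᵇ d))) z))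
                (cnt-cong vs _ _ (All.universal (λ x e → ∧-swap₃ (φ x e) _ _) vs)) ⟩
      when (φ w d) (when (φ u c ∧ not (adj u w ∧ (c ≡ᵇ d))) (rest′ c d)) ∎

  cnt-↭ : ∀ {xs ys} → xs ↭ ys → ∀ φ → cnt xs φ ≡ cnt ys φ
  cnt-↭ refl          φ = Eq.refl
  cnt-↭ (prep x p)    φ = Σ<-cong q (λ c _ → cong (when (φ x c)) (cnt-↭ p _))
  cnt-↭ {_ ∷ _ ∷ xs} (swap x y p) φ = Eq.trans (cnt-swap x y xs φ)
    (Σ<-cong q (λ c _ → cong (when (φ y c)) (Σ<-cong q (λ d _ → cong (when _) (cnt-↭ p _)))))
  cnt-↭ (trans p p′)  φ = Eq.trans (cnt-↭ p φ) (cnt-↭ p′ φ)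

numColourings≡cnt : (G : Graph) → (∀ x y → Graph.adj G x y ≡ Graph.adj G y x) → ∀ q →
  + numColourings G q ≡ Sequential.cnt (Graph.adj G) q (Graph.verts G) (λ _ _ → true)
numColourings≡cnt G adjSym q = begin
  + numColourings G q
    ≡⟨ length-filter (properᵇ adj vs) words ⟩
  countWhere (properᵇ adj vs) words
    ≡⟨ countWhere-cong words (λ cs → sym (Eq.trans (cong (properᵇ adj vs cs ∧_) (respects-anything vs cs))
                                                   (BP.∧-identityʳ _))) ⟩
  countWhere (λ cs → properᵇ adj vs cs ∧ respects vs cs (λ _ _ → true)) words
    ≡⟨ cnt-counts vs (λ _ _ → true) ⟩
  Sequential.cnt adj q vs (λ _ _ → true) ∎
  where
  open Graph G using (adj) renaming (verts to vs)
  open Symmetric adj adjSym q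
  words = colourings q (length vs)
  respects-anything : ∀ vs cs → respects vs cs (λ _ _ → true) ≡ true
  respects-anything []       cs       = Eq.refl
  respects-anything (v ∷ vs) []       = Eq.refl
  respects-anything (v ∷ vs) (c ∷ cs) = respects-anything vs cs

elemᵇ : ℕ → List ℕ → Bool
elemᵇ x []       = false
elemᵇ x (y ∷ ys) = (x ≡ᵇ y) ∨ elemᵇ x ys

Distinct : List ℕ → Set
Distinct []      = ⊤
Distinct (c ∷ l) = (elemᵇ c l ≡ false) × Distinct l

elemᵇ-≡ᵇ : ∀ d a F → (d ≡ᵇ a) ≡ true → elemᵇ d F ≡ elemᵇ a F
elemᵇ-≡ᵇ d a F e = cong (λ z → elemᵇ z F) (≡ᵇ⇒≡ e)

count-remove : ∀ q (p : ℕ → Bool) c → c < q → p c ≡ true →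
               count q (λ x → p x ∧ not (x ≡ᵇ c)) ≡ count q p - 1ℤ
count-remove q p c c<q pc = begin
  count q (λ x → p x ∧ not (x ≡ᵇ c))                                  ≡⟨ sym (cancel _ _) ⟩
  (count q (λ x → p x ∧ not (x ≡ᵇ c)) + atC) - atC
    ≡⟨ cong (_- atC) (Eq.trans (sym (Σ<-+ q _ _)) (sym (Σ<-cong q (λ x _ → split x)))) ⟩
  count q p - atC                                                     ≡⟨ cong (λ z → count q p - z) atC≡1 ⟩
  count q p - 1ℤ                                                      ∎
  where
  atC = Σ< q (λ x → when (x ≡ᵇ c) (when (p x) 1ℤ))
  atC≡1 : atC ≡ 1ℤ
  atC≡1 = Eq.trans (Σ<-single q c (λ x → when (p x) 1ℤ) c<q) (cong (λ b → when b 1ℤ) pc)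
  split : ∀ x → when (p x) 1ℤ ≡ when (p x ∧ not (x ≡ᵇ c)) 1ℤ + when (x ≡ᵇ c) (when (p x) 1ℤ)
  split x with p x | x ≡ᵇ c
  ... | true  | true  = Eq.refl
  ... | true  | false = Eq.refl
  ... | false | true  = Eq.refl
  ... | false | false = Eq.refl
  cancel : ∀ a b → (a + b) - b ≡ a
  cancel = solve-∀

count-avoiding : ∀ q (p : ℕ → Bool) acc → Distinct acc → All (_< q) acc → All (λ c → p c ≡ true) acc →
                 count q (λ x → p x ∧ not (elemᵇ x acc)) ≡ count q p - + length acc
count-avoiding q p []        _        _            _          =
  Eq.trans (count-cong q (λ x → BP.∧-identityʳ (p x))) (sym (ZP.+-identityʳ _))
count-avoiding q p (a ∷ acc) (a∉ , d) (a<q ∷ bacc) (pa ∷ ps) = begin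
  count q (λ x → p x ∧ not ((x ≡ᵇ a) ∨ elemᵇ x acc))
    ≡⟨ count-cong q (λ x → not-∨-∧ (p x) (x ≡ᵇ a) (elemᵇ x acc)) ⟩
  count q (λ x → (p x ∧ not (elemᵇ x acc)) ∧ not (x ≡ᵇ a))
    ≡⟨ count-remove q _ a a<q (cong₂ (λ u v → u ∧ not v) pa a∉) ⟩
  count q (λ x → p x ∧ not (elemᵇ x acc)) - 1ℤ
    ≡⟨ cong (_- 1ℤ) (count-avoiding q p acc d bacc ps) ⟩
  (count q p - + length acc) - 1ℤ
    ≡⟨ lem (count q p) (+ length acc) ⟩
  count q p - + length (a ∷ acc) ∎
  where lem : ∀ x y → (x - y) - 1ℤ ≡ x - (1ℤ + y)
        lem = solve-∀

-- Sums over injective colourings of a clique. `injSum d acc g` sums g(c_d ∷ … ∷ c₁ ∷ acc)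
-- over all sequences of d distinct allowed colours < q avoiding the colours in acc.
module InjectiveChoices (q : ℕ) (allow : ℕ → Bool) where

  fresh : List ℕ → ℕ → Bool
  fresh acc c = allow c ∧ not (elemᵇ c acc)

  injSum : ℕ → List ℕ → (List ℕ → ℤ) → ℤ
  injSum zero    acc g = g acc
  injSum (suc d) acc g = Σ< q (λ c → when (fresh acc c) (injSum d (c ∷ acc) g))

  available : List ℕ → ℤ
  available acc = count q (fresh acc)

  fresh-step : ∀ acc c → Distinct acc → c < q → fresh acc c ≡ true →
               Distinct (c ∷ acc) × (available (c ∷ acc) ≡ available acc - 1ℤ)
  fresh-step acc c dacc c<q c-fresh =
    (c∉acc c-fresh , dacc) ,
    Eq.trans (count-cong q (λ x → not-∨-∧ (allow x) (x ≡ᵇ c) (elemᵇ x acc)))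
             (count-remove q (fresh acc) c c<q c-fresh)
    where c∉acc : ∀ {u v} → u ∧ not v ≡ true → v ≡ false
          c∉acc {true} e = not-true e

  -- The partial choices acc met by the recursion, with d colours still to choose.
  record Partial (L d : ℕ) (M : ℤ) (acc : List ℕ) : Set where
    field
      distinct  : Distinct acc
      bounded   : All (_< q) acc
      size      : length acc ℕ.+ d ≡ L
      remaining : available acc ≡ M

  start : ∀ {d M} → available [] ≡ M → Partial d d M []
  start e = record { distinct = tt ; bounded = [] ; size = Eq.refl ; remaining = e }

  extend : ∀ {L d M acc c} → Partial L (suc d) M acc → c < q → fresh acc c ≡ true →
           Partial L d (M - 1ℤ) (c ∷ acc)
  extend {d = d} {acc = acc} {c} P c<q c-fresh = record
    { distinct  = proj₁ step
    ; bounded   = c<q ∷ bounded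
    ; size      = Eq.trans (sym (NP.+-suc (length acc) d)) size
    ; remaining = Eq.trans (proj₂ step) (cong (_- 1ℤ) remaining) }
    where open Partial P
          step = fresh-step acc c distinct c<q c-fresh

  injSum-step : ∀ {L d M acc} (g : List ℕ → ℤ) (G : ℤ) → Partial L (suc d) M acc →
                (∀ c → c < q → fresh acc c ≡ true → injSum d (c ∷ acc) g ≡ G) →
                injSum (suc d) acc g ≡ M * G
  injSum-step {d = d} {M} {acc} g G P h = begin
    Σ< q (λ c → when (fresh acc c) (injSum d (c ∷ acc) g)) ≡⟨ Σ<-cong q (λ c c<q → when-cond _ _ _ (h c c<q)) ⟩
    Σ< q (λ c → when (fresh acc c) G)                      ≡⟨ Σ<-const q _ G ⟩
    available acc * G                                      ≡⟨ cong (_* G) (Partial.remaining P) ⟩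
    M * G                                                  ∎

  Σ<-split-at : ∀ acc a → a < q → fresh acc a ≡ true → ∀ x y →
                Σ< q (λ c → when (fresh acc c) (when (a ≡ᵇ c) x + y)) ≡ x + available acc * y
  Σ<-split-at acc a a<q a-fresh x y = begin
    Σ< q (λ c → when (fresh acc c) (when (a ≡ᵇ c) x + y))
      ≡⟨ Σ<-cong q (λ c _ → when-+ (fresh acc c) _ y) ⟩
    Σ< q (λ c → when (fresh acc c) (when (a ≡ᵇ c) x) + when (fresh acc c) y)
      ≡⟨ Σ<-+ q _ _ ⟩
    Σ< q (λ c → when (fresh acc c) (when (a ≡ᵇ c) x)) + Σ< q (λ c → when (fresh acc c) y)
      ≡⟨ cong₂ _+_ only-a (Σ<-const q (fresh acc) y) ⟩
    x + available acc * y ∎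
    where
    only-a : Σ< q (λ c → when (fresh acc c) (when (a ≡ᵇ c) x)) ≡ x
    only-a = begin
      Σ< q (λ c → when (fresh acc c) (when (a ≡ᵇ c) x))
        ≡⟨ Σ<-cong q (λ c _ → Eq.trans (when-comm (fresh acc c) (a ≡ᵇ c) x)
                                       (cong (λ z → when z (when (fresh acc c) x)) (≡ᵇ-sym a c))) ⟩
      Σ< q (λ c → when (c ≡ᵇ a) (when (fresh acc c) x)) ≡⟨ Σ<-single q a _ a<q ⟩
      when (fresh acc a) x                              ≡⟨ cong (λ b → when b x) a-fresh ⟩
      x                                                 ∎

  -- Colourings of a clique whose count depends only on whether a special colour a
  -- is used in the final list: g acc = h (a ∈ acc).
  module SpecialColour (a : ℕ) (h : Bool → ℤ) (g : List ℕ → ℤ) (L : ℕ)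
           (hg : ∀ acc → Distinct acc → All (_< q) acc → length acc ≡ L → g acc ≡ h (elemᵇ a acc)) where

    at-end : ∀ {M acc} → Partial L 0 M acc → g acc ≡ h (elemᵇ a acc)
    at-end {acc = acc} P = hg acc distinct bounded (Eq.trans (sym (NP.+-identityʳ _)) size)
      where open Partial P

    -- Whether a is used cannot change any more if a is already used or is not allowed.
    Settled : List ℕ → Set
    Settled acc = elemᵇ a acc ∨ not (allow a) ≡ true

    settled-stable : ∀ acc c → Settled acc → fresh acc c ≡ true → elemᵇ a (c ∷ acc) ≡ elemᵇ a acc
    settled-stable acc c s c-fresh with elemᵇ a acc
    ... | true  = BP.∨-zeroʳ _
    ... | false = Eq.trans (BP.∨-identityʳ _) (≢⇒≡ᵇ-false a≢c)
      where
      a≢c : ¬ a ≡ c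
      a≢c a≡c = false≢true (Eq.trans (sym (not-true s)) (Eq.trans (cong allow a≡c) (∧-true₁ c-fresh)))

    injSum-settled : ∀ d {M acc} → Partial L d M acc → Settled acc → injSum d acc g ≡ M ↓ d * h (elemᵇ a acc)
    injSum-settled zero    P s = Eq.trans (at-end P) (sym (ZP.*-identityˡ _))
    injSum-settled (suc d) {M} {acc} P s =
      Eq.trans (injSum-step g _ P (λ c c<q c-fresh → begin
        injSum d (c ∷ acc) g                          ≡⟨ injSum-settled d (extend P c<q c-fresh)
                                                            (subst (λ z → z ∨ not (allow a) ≡ true)
                                                                   (sym (settled-stable acc c s c-fresh)) s) ⟩
        (M - 1ℤ) ↓ d * h (elemᵇ a (c ∷ acc))          ≡⟨ cong (λ z → (M - 1ℤ) ↓ d * h z) (settled-stable acc c s c-fresh) ⟩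
        (M - 1ℤ) ↓ d * h (elemᵇ a acc)                ∎))
      (sym (ZP.*-assoc M _ _))


    -- If a is allowed but not yet used, it is either used by this clique or not.
    injSum-special : ∀ d {M acc} → a < q → Partial L d M acc → allow a ≡ true → elemᵇ a acc ≡ false →
                     injSum d acc g ≡ + d * (M - 1ℤ) ↓ (d ∸ 1) * h true + (M - 1ℤ) ↓ d * h false
    injSum-special zero    a<q P allow-a a∉acc = Eq.trans (at-end P) (Eq.trans (cong h a∉acc) (lem (h true) (h false)))
      where lem : ∀ x y → y ≡ 0ℤ * 1ℤ * x + 1ℤ * y
            lem = solve-∀
    injSum-special (suc d) {M} {acc} a<q P allow-a a∉acc = begin
      Σ< q (λ c → when (fresh acc c) (injSum d (c ∷ acc) g))
        ≡⟨ Σ<-cong q (λ c c<q → when-cond _ _ _ (by-choice c c<q)) ⟩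
      Σ< q (λ c → when (fresh acc c) (when (a ≡ᵇ c) (A - B) + B))
        ≡⟨ Σ<-split-at acc a a<q a-fresh (A - B) B ⟩
      (A - B) + available acc * B
        ≡⟨ cong (λ z → (A - B) + z * B) (Partial.remaining P) ⟩
      (A - B) + M * B
        ≡⟨ expand M (+ d) F₁ F₂ F₂′ (h true) (h false) ⟩
      F₁ * h true + (M - 1ℤ) * (+ d * F₂′) * h true + (M - 1ℤ) * F₂ * h false
        ≡⟨ cong (λ z → F₁ * h true + z * h true + (M - 1ℤ) * F₂ * h false) (↓-absorb (M - 1ℤ) d) ⟩
      F₁ * h true + + d * F₁ * h true + (M - 1ℤ) * F₂ * h false
        ≡⟨ collect (+ d) F₁ ((M - 1ℤ) * F₂) (h true) (h false) ⟩
      + suc d * F₁ * h true + (M - 1ℤ) ↓ suc d * h false ∎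
      where
      F₁ = (M - 1ℤ) ↓ d
      F₂ = ((M - 1ℤ) - 1ℤ) ↓ d
      F₂′ = ((M - 1ℤ) - 1ℤ) ↓ (d ∸ 1)
      -- A: a is used now; B: a is still unused.
      A = F₁ * h true
      B = + d * F₂′ * h true + F₂ * h false
      a-fresh : fresh acc a ≡ true
      a-fresh = cong₂ (λ u v → u ∧ not v) allow-a a∉acc
      by-choice : ∀ c → c < q → fresh acc c ≡ true → injSum d (c ∷ acc) g ≡ when (a ≡ᵇ c) (A - B) + B
      by-choice c c<q c-fresh with a ≡ᵇ c in a≟c
      ... | true  = Eq.trans (injSum-settled d (extend P c<q c-fresh) (cong (λ z → (z ∨ elemᵇ a acc) ∨ not (allow a)) a≟c))
                             (Eq.trans (cong (λ z → F₁ * h (z ∨ elemᵇ a acc)) a≟c) (sym (lem A B)))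
        where lem : ∀ x y → (x - y) + y ≡ x
              lem = solve-∀
      ... | false = Eq.trans (injSum-special d a<q (extend P c<q c-fresh) allow-a (Eq.trans (cong (_∨ elemᵇ a acc) a≟c) a∉acc))
                             (sym (ZP.+-identityˡ B))
      expand : ∀ m dd f₁ f₂ f₂′ t f → (f₁ * t - (dd * f₂′ * t + f₂ * f)) + m * (dd * f₂′ * t + f₂ * f)
               ≡ f₁ * t + (m - 1ℤ) * (dd * f₂′) * t + (m - 1ℤ) * f₂ * f
      expand = solve-∀
      collect : ∀ dd f₁ g t f → f₁ * t + dd * f₁ * t + g * f ≡ (1ℤ + dd) * f₁ * t + g * f
      collect = solve-∀

-- If ws is a clique whose vertices all currently allow
-- exactly the colours fresh for acc, and every later vertex v is adjacent either to
-- all of ws (β v) or to none of it, then colouring ws amounts to choosing an injective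
-- colouring κ of ws and forbidding the colours of κ at the β-vertices.
module Cliques {V : Set} (adj : V → V → Bool) (q : ℕ) where
  open Sequential adj q

  IsClique : List V → Set
  IsClique = AllPairs (λ w w′ → adj w′ w ≡ true)

  avoiding : Constraint → (V → Bool) → List ℕ → Constraint
  avoiding ψ β κ w d = ψ w d ∧ not (β w ∧ elemᵇ d κ)

  avoiding-nothing : ∀ ψ β w d → ψ w d ≡ avoiding ψ β [] w d
  avoiding-nothing ψ β w d =
    sym (Eq.trans (cong (λ z → ψ w d ∧ not z) (BP.∧-zeroʳ (β w))) (BP.∧-identityʳ (ψ w d)))

  cnt-clique : ∀ ws vs (β : V → Bool) (allow : ℕ → Bool) (ψ φ : Constraint) acc → IsClique ws →
    All (λ v → All (λ w → adj v w ≡ β v) ws) vs →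
    All (λ w → ∀ d → φ w d ≡ InjectiveChoices.fresh q allow acc d) ws →
    All (λ v → ∀ d → φ v d ≡ avoiding ψ β acc v d) vs →
    cnt (ws ++ vs) φ ≡ InjectiveChoices.injSum q allow (length ws) acc (λ κ → cnt vs (avoiding ψ β κ))
  cnt-clique []       vs β allow ψ φ acc _ hβ hws hvs = cnt-cong vs _ _ hvs
  cnt-clique (w ∷ ws) vs β allow ψ φ acc (w~ws ∷ clique) hβ (hw ∷ hws) hvs =
    Σ<-cong q (λ c _ → cong₂ when (hw c)
      (cnt-clique ws vs β allow ψ (forbid w c φ) (c ∷ acc) clique (All.map All.tail hβ)
                  (clique-step w~ws hws) (rest-step hβ hvs)))
    where
    fresh-forbid : ∀ u e y → (u ∧ not e) ∧ not (true ∧ y) ≡ u ∧ not (y ∨ e)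
    fresh-forbid u e true  = Eq.trans (BP.∧-zeroʳ _) (sym (BP.∧-zeroʳ u))
    fresh-forbid u e false = BP.∧-identityʳ _
    avoid-forbid : ∀ u b e y → (u ∧ not (b ∧ e)) ∧ not (b ∧ y) ≡ u ∧ not (b ∧ (y ∨ e))
    avoid-forbid u false e y    = BP.∧-identityʳ _
    avoid-forbid u true  e true  = Eq.trans (BP.∧-zeroʳ _) (sym (BP.∧-zeroʳ u))
    avoid-forbid u true  e false = BP.∧-identityʳ _
    clique-step : ∀ {us c} → All (λ u → adj u w ≡ true) us →
                  All (λ u → ∀ d → φ u d ≡ InjectiveChoices.fresh q allow acc d) us →
                  All (λ u → ∀ d → forbid w c φ u d ≡ InjectiveChoices.fresh q allow (c ∷ acc) d) us
    clique-step []             []           = []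
    clique-step {c = c} (e ∷ es) (h ∷ hs) =
      (λ d → Eq.trans (cong₂ (λ x y → x ∧ not (y ∧ (d ≡ᵇ c))) (h d) e)
                      (fresh-forbid (allow d) (elemᵇ d acc) (d ≡ᵇ c))) ∷ clique-step es hs
    rest-step : ∀ {us c} → All (λ u → All (λ w′ → adj u w′ ≡ β u) (w ∷ ws)) us →
                All (λ u → ∀ d → φ u d ≡ avoiding ψ β acc u d) us →
                All (λ u → ∀ d → forbid w c φ u d ≡ avoiding ψ β (c ∷ acc) u d) us
    rest-step []                  []       = []
    rest-step {u ∷ _} {c} ((e ∷ _) ∷ es) (h ∷ hs) =
      (λ d → Eq.trans (cong₂ (λ x y → x ∧ not (y ∧ (d ≡ᵇ c))) (h d) e)
                      (avoid-forbid (ψ u d) (β u) (elemᵇ d acc) (d ≡ᵇ c))) ∷ rest-step es hs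

-- Colourings of what remains of a clique path, read from the final clique towards the
-- apex: rs lists the remaining clique sizes, the already coloured neighbouring clique
-- uses s colours, and `used` records whether the apex colour is among them. A block is
-- coloured injectively avoiding those s colours; it may take the apex colour only if
-- that is still free, and the empty rest is consistent iff the apex colour is unused.
pathCount : ℤ → List ℕ → ℕ → Bool → ℤ
pathCount x []       s used  = when (not used) 1ℤ
pathCount x (b ∷ rs) s true  = (x - + s) ↓ b * pathCount x rs b false
pathCount x (b ∷ rs) s false = + b * ((x - + s) - 1ℤ) ↓ (b ∸ 1) * pathCount x rs b true
                             + ((x - + s) - 1ℤ) ↓ b * pathCount x rs b false

thetaAdj-sym : ∀ Ss x y → thetaAdj Ss x y ≡ thetaAdj Ss y x
thetaAdj-sym Ss x y = BP.∨-comm (adjDir Ss x y) (adjDir Ss y x)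

-- Block l of path i, and the blocks of path i listed from the highest index down:
-- for rs = (b_m, …, b₁) block l has size b_{l+1}.
block : ℕ → ℕ → ℕ → List TV
block i l b = map (inner i l) (upTo b)

pathVerts : ℕ → List ℕ → List TV
pathVerts i []       = []
pathVerts i (b ∷ rs) = block i (length rs) b ++ pathVerts i rs

InBlock : ℕ → ℕ → TV → Set
InBlock i L (inner i′ l c) = (i′ ≡ i) × (l ≡ L)
InBlock i L _              = ⊥

InPath : ℕ → ℕ → TV → Set
InPath i m (inner i′ l c) = (i′ ≡ i) × (l < m)
InPath i m _              = ⊥

block-in : ∀ i L (cs : List ℕ) → All (InBlock i L) (map (inner i L) cs)
block-in i L []       = []
block-in i L (c ∷ cs) = (Eq.refl , Eq.refl) ∷ block-in i L cs

pathVerts-in : ∀ i rs → All (InPath i (length rs)) (pathVerts i rs)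
pathVerts-in i []       = []
pathVerts-in i (b ∷ rs) = AllP.++⁺
  (All.map (λ { {inner _ _ _} (i≡ , Eq.refl) → i≡ , NP.n<1+n _ }) (block-in i (length rs) (upTo b)))
  (All.map (λ { {inner _ _ _} (i≡ , l<) → i≡ , NP.m<n⇒m<1+n l< }) (pathVerts-in i rs))

module PathColourings (Ss : List (List⁺ ℕ)) (q a : ℕ) (a<q : a < q) (i : ℕ) where
  adj = thetaAdj Ss
  open Sequential adj q
  open Cliques adj q

  X : ℤ
  X = + q

  -- With blocks below m left and the next block coloured by F: block 0 avoids the apex
  -- colour and block m-1 avoids F.
  pathConstraint : ℕ → List ℕ → Constraint
  pathConstraint m F (inner _ l _) d = not ((l ≡ᵇ 0) ∧ (d ≡ᵇ a)) ∧ not ((suc l ≡ᵇ m) ∧ elemᵇ d F)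
  pathConstraint m F _             d = true

  allowedIn : ℕ → List ℕ → ℕ → Bool
  allowedIn L F d = not ((L ≡ᵇ 0) ∧ (d ≡ᵇ a)) ∧ not (elemᵇ d F)

  nextTo : ℕ → TV → Bool
  nextTo L (inner _ l _) = suc l ≡ᵇ L
  nextTo L _             = false

  block-clique : ∀ L cs → Unique cs → IsClique (map (inner i L) cs)
  block-clique L []       []           = []
  block-clique L (c ∷ cs) (c∉ ∷ uniq) = edges cs c∉ ∷ block-clique L cs uniq
    where
    edges : ∀ ds → All (λ d → ¬ c ≡ d) ds → All (λ w → adj w (inner i L c) ≡ true) (map (inner i L) ds)
    edges []       []         = []
    edges (d ∷ ds) (c≢d ∷ ns) = edge ∷ edges ds ns
      where edge : adj (inner i L d) (inner i L c) ≡ true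
            edge rewrite ≡ᵇ-refl i | ≡ᵇ-refl L | ≢⇒≡ᵇ-false {d} {c} (λ e → c≢d (sym e)) = Eq.refl

  adj-block : ∀ L {v w} → InPath i L v → InBlock i L w → adj v w ≡ nextTo L v
  adj-block L {inner .i l _} {inner .i .L _} (Eq.refl , l<L) (Eq.refl , Eq.refl)
    rewrite ≡ᵇ-refl i | <⇒≡ᵇ-false l<L | >⇒≡ᵇ-false l<L | <⇒≡ᵇ-false {l} {suc L} (NP.m<n⇒m<1+n l<L) =
      Eq.trans (BP.∨-identityʳ _) (≡ᵇ-sym L (suc l))

  PathConstrained : ℕ → List ℕ → Constraint → List TV → Set
  PathConstrained m F φ = All (λ w → ∀ d → φ w d ≡ pathConstraint m F w d)

  colour-top-block : ∀ b rs F φ → PathConstrained (suc (length rs)) F φ (pathVerts i (b ∷ rs)) →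
    cnt (pathVerts i (b ∷ rs)) φ
    ≡ InjectiveChoices.injSum q (allowedIn (length rs) F) b [] (λ κ → cnt (pathVerts i rs) (avoiding φ (nextTo (length rs)) κ))
  colour-top-block b rs F φ constrained =
    Eq.trans (cnt-clique (block i L b) (pathVerts i rs) (nextTo L) (allowedIn L F) φ φ []
                         (block-clique L (upTo b) (upTo⁺ b)) next top rest)
             (cong (λ n → InjectiveChoices.injSum q (allowedIn L F) n [] _)
                   (Eq.trans (LP.length-map (inner i L) (upTo b)) (LP.length-upTo b)))
    where
    L = length rs
    next : All (λ v → All (λ w → adj v w ≡ nextTo L v) (block i L b)) (pathVerts i rs)
    next = All.map (λ v-in → All.map (adj-block L v-in) (block-in i L (upTo b))) (pathVerts-in i rs)
    top : All (λ w → ∀ d → φ w d ≡ InjectiveChoices.fresh q (allowedIn L F) [] d) (block i L b)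
    top = All.zipWith (λ { {inner .i .L _} ((Eq.refl , Eq.refl) , h) d →
            Eq.trans (h d) (Eq.trans (cong (λ z → not ((L ≡ᵇ 0) ∧ (d ≡ᵇ a)) ∧ not (z ∧ elemᵇ d F)) (≡ᵇ-refl L))
                                     (sym (BP.∧-identityʳ _))) })
            (block-in i L (upTo b) , AllP.++⁻ˡ (block i L b) constrained)
    rest : All (λ v → ∀ d → φ v d ≡ avoiding φ (nextTo L) [] v d) (pathVerts i rs)
    rest = All.universal (λ v → avoiding-nothing φ (nextTo L) v) _

  below-top-block : ∀ b rs F φ κ → PathConstrained (suc (length rs)) F φ (pathVerts i (b ∷ rs)) →
                    PathConstrained (length rs) κ (avoiding φ (nextTo (length rs)) κ) (pathVerts i rs)
  below-top-block b rs F φ κ constrained =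
    All.zipWith (λ { {inner .i l c} ((Eq.refl , l<L) , h) d → begin
        φ (inner i l c) d ∧ not ((suc l ≡ᵇ L) ∧ elemᵇ d κ)
          ≡⟨ cong (_∧ not ((suc l ≡ᵇ L) ∧ elemᵇ d κ)) (h d) ⟩
        (not ((l ≡ᵇ 0) ∧ (d ≡ᵇ a)) ∧ not ((l ≡ᵇ L) ∧ elemᵇ d F)) ∧ not ((suc l ≡ᵇ L) ∧ elemᵇ d κ)
          ≡⟨ cong (λ z → (not ((l ≡ᵇ 0) ∧ (d ≡ᵇ a)) ∧ not (z ∧ elemᵇ d F)) ∧ not ((suc l ≡ᵇ L) ∧ elemᵇ d κ))
                  (<⇒≡ᵇ-false l<L) ⟩
        (not ((l ≡ᵇ 0) ∧ (d ≡ᵇ a)) ∧ true) ∧ not ((suc l ≡ᵇ L) ∧ elemᵇ d κ)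
          ≡⟨ cong (_∧ not ((suc l ≡ᵇ L) ∧ elemᵇ d κ)) (BP.∧-identityʳ _) ⟩
        pathConstraint L κ (inner i l c) d ∎ })
      (pathVerts-in i rs , AllP.++⁻ʳ (block i (length rs) b) constrained)
    where L = length rs

  module _ (F : List ℕ) (dF : Distinct F) (bF : All (_< q) F) where
    open InjectiveChoices q using (available)

    avoid-F : count q (λ d → not (elemᵇ d F)) ≡ X - + length F
    avoid-F = Eq.trans (count-avoiding q (λ _ → true) F dF bF (All.universal (λ _ → Eq.refl) F))
                       (cong (_- + length F) (count-all q))

    available-upper : ∀ m → available (allowedIn (suc m) F) [] ≡ X - + length F
    available-upper m = Eq.trans (count-cong q (λ d → BP.∧-identityʳ _)) avoid-F

    available-bottom-used : elemᵇ a F ≡ true → available (allowedIn 0 F) [] ≡ X - + length F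
    available-bottom-used a∈F = Eq.trans (count-cong q same) avoid-F
      where
      same : ∀ d → allowedIn 0 F d ∧ true ≡ not (elemᵇ d F)
      same d with d ≡ᵇ a in d≟a
      ... | false = BP.∧-identityʳ _
      ... | true  = cong not (sym (Eq.trans (elemᵇ-≡ᵇ d a F d≟a) a∈F))

    available-bottom-unused : elemᵇ a F ≡ false → available (allowedIn 0 F) [] ≡ (X - + length F) - 1ℤ
    available-bottom-unused a∉F = begin
      available (allowedIn 0 F) []                     ≡⟨ count-cong q (λ d → BP.∧-identityʳ _) ⟩
      count q (λ d → not (d ≡ᵇ a) ∧ not (elemᵇ d F))   ≡⟨ count-avoiding q (λ d → not (d ≡ᵇ a)) F dF bF (differ F a∉F) ⟩
      count q (λ d → not (d ≡ᵇ a)) - + length F        ≡⟨ cong (_- + length F) (count-remove q (λ _ → true) a a<q Eq.refl) ⟩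
      (count q (λ _ → true) - 1ℤ) - + length F         ≡⟨ cong (λ z → (z - 1ℤ) - + length F) (count-all q) ⟩
      (X - 1ℤ) - + length F                            ≡⟨ swap-sub X (+ length F) ⟩
      (X - + length F) - 1ℤ                            ∎
      where
      differ : ∀ G → elemᵇ a G ≡ false → All (λ c → not (c ≡ᵇ a) ≡ true) G
      differ []      _    = []
      differ (c ∷ G) a∉cG with a ≡ᵇ c in a≟c
      ... | false = cong not (Eq.trans (≡ᵇ-sym c a) a≟c) ∷ differ G a∉cG
      swap-sub : ∀ x y → (x - 1ℤ) - y ≡ (x - y) - 1ℤ
      swap-sub = solve-∀

  path-count : ∀ b rs F φ → Distinct F → All (_< q) F →
               PathConstrained (suc (length rs)) F φ (pathVerts i (b ∷ rs)) →
               cnt (pathVerts i (b ∷ rs)) φ ≡ pathCount X (b ∷ rs) (length F) (elemᵇ a F)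
  path-count b [] F φ dF bF constrained =
    Eq.trans (colour-top-block b [] F φ constrained) (bottom (elemᵇ a F) Eq.refl)
    where
    open InjectiveChoices q (allowedIn 0 F)
    open SpecialColour a (λ _ → 1ℤ) (λ _ → 1ℤ) b (λ _ _ _ _ → Eq.refl)
    -- The apex colour is never allowed in block 0.
    settled : Settled []
    settled = cong (λ z → not (not z ∧ not (elemᵇ a F))) (≡ᵇ-refl a)
    bottom : ∀ used → elemᵇ a F ≡ used → injSum b [] (λ _ → 1ℤ) ≡ pathCount X (b ∷ []) (length F) used
    bottom true  a∈F = injSum-settled b (start (available-bottom-used F dF bF a∈F)) settled
    bottom false a∉F = Eq.trans (injSum-settled b (start (available-bottom-unused F dF bF a∉F)) settled)
                                (lem (+ b * ((X - + length F) - 1ℤ) ↓ (b ∸ 1)) _)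
      where lem : ∀ u v → v ≡ u * 0ℤ + v
            lem = solve-∀
  path-count b (b′ ∷ rs) F φ dF bF constrained =
    Eq.trans (colour-top-block b (b′ ∷ rs) F φ constrained) (upper (elemᵇ a F) Eq.refl)
    where
    L = length (b′ ∷ rs)
    open InjectiveChoices q (allowedIn L F)
    g : List ℕ → ℤ
    g κ = cnt (pathVerts i (b′ ∷ rs)) (avoiding φ (nextTo L) κ)
    below : ∀ κ → Distinct κ → All (_< q) κ → length κ ≡ b → g κ ≡ pathCount X (b′ ∷ rs) b (elemᵇ a κ)
    below κ dκ bκ |κ| = Eq.trans (path-count b′ rs κ _ dκ bκ (below-top-block b (b′ ∷ rs) F φ κ constrained))
                                 (cong (λ s → pathCount X (b′ ∷ rs) s (elemᵇ a κ)) |κ|)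
    open SpecialColour a (pathCount X (b′ ∷ rs) b) g b below
    upper : ∀ used → elemᵇ a F ≡ used → injSum b [] g ≡ pathCount X (b ∷ b′ ∷ rs) (length F) used
    upper true  a∈F = injSum-settled b (start (available-upper F dF bF (length rs))) (cong (λ z → not (not z)) a∈F)
    upper false a∉F = injSum-special b a<q (start (available-upper F dF bF (length rs))) (cong not a∉F) Eq.refl

-- The vertex list of Defs lists the paths in order with their blocks in increasing
-- order of index, followed by the final clique. Up to permutation it is the apex,
-- the final clique, and each path with its blocks in decreasing order.
forwardBlocks : ℕ → (ℕ → ℕ) → List ℕ → List TV
forwardBlocks i g []       = []
forwardBlocks i g (b ∷ bs) = block i (g 0) b ++ forwardBlocks i (λ x → g (suc x)) bs

backwardBlocks : ℕ → (ℕ → ℕ) → List ℕ → List TV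
backwardBlocks i g []       = []
backwardBlocks i g (b ∷ rs) = block i (g (length rs)) b ++ backwardBlocks i g rs

backwardBlocks-id : ∀ i rs → backwardBlocks i (λ x → x) rs ≡ pathVerts i rs
backwardBlocks-id i []       = Eq.refl
backwardBlocks-id i (b ∷ rs) = cong (block i (length rs) b ++_) (backwardBlocks-id i rs)

backwardBlocks-∷ʳ : ∀ i g rs b →
  backwardBlocks i g (rs ++ b ∷ []) ≡ backwardBlocks i (λ x → g (suc x)) rs ++ block i (g 0) b
backwardBlocks-∷ʳ i g []        b = LP.++-identityʳ _
backwardBlocks-∷ʳ i g (b′ ∷ rs) b = begin
  block i (g (length (rs ++ b ∷ []))) b′ ++ backwardBlocks i g (rs ++ b ∷ [])
    ≡⟨ cong₂ _++_ (cong (λ n → block i (g n) b′) (Eq.trans (LP.length-++ rs) (NP.+-comm (length rs) 1)))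
                  (backwardBlocks-∷ʳ i g rs b) ⟩
  block i (g (suc (length rs))) b′ ++ (backwardBlocks i (λ x → g (suc x)) rs ++ block i (g 0) b)
    ≡⟨ sym (LP.++-assoc (block i (g (suc (length rs))) b′) _ _) ⟩
  (block i (g (suc (length rs))) b′ ++ backwardBlocks i (λ x → g (suc x)) rs) ++ block i (g 0) b ∎

forward↭backward : ∀ i g bs → forwardBlocks i g bs ↭ backwardBlocks i g (reverse bs)
forward↭backward i g []       = ↭-refl
forward↭backward i g (b ∷ bs) =
  ↭-trans (PermP.++⁺ˡ (block i (g 0) b) (forward↭backward i (λ x → g (suc x)) bs))
  (↭-trans (PermP.++-comm (block i (g 0) b) _)
           (Eq.subst (backwardBlocks i (λ x → g (suc x)) (reverse bs) ++ block i (g 0) b ↭_)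
                     (sym (Eq.trans (cong (backwardBlocks i g) (LP.unfold-reverse b bs))
                                           (backwardBlocks-∷ʳ i g (reverse bs) b))) ↭-refl))

allPaths : (ℕ → ℕ) → List (List⁺ ℕ) → List TV
allPaths g []       = []
allPaths g (S ∷ Ss) = pathVerts (g 0) (reverse (toList S)) ++ allPaths (λ x → g (suc x)) Ss

listedPaths : (ℕ → ℕ) → List (List⁺ ℕ) → List TV
listedPaths g []       = []
listedPaths g (S ∷ Ss) = forwardBlocks (g 0) (λ x → x) (toList S) ++ listedPaths (λ x → g (suc x)) Ss

listedPaths-↭ : ∀ g Ss → listedPaths g Ss ↭ allPaths g Ss
listedPaths-↭ g []       = ↭-refl
listedPaths-↭ g (S ∷ Ss) =
  PermP.++⁺ (Eq.subst (forwardBlocks (g 0) (λ x → x) (toList S) ↭_) (backwardBlocks-id (g 0) (reverse (toList S)))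
                      (forward↭backward (g 0) (λ x → x) (toList S)))
            (listedPaths-↭ (λ x → g (suc x)) Ss)

thetaVerts-↭ : ∀ Ss k → thetaVerts Ss k ↭ apex ∷ (map final (upTo k) ++ allPaths (λ x → x) Ss)
thetaVerts-↭ Ss k = prep apex
  (↭-trans (PermP.++-comm _ (map final (upTo k)))
           (PermP.++⁺ˡ (map final (upTo k))
              (Eq.subst (_↭ allPaths (λ x → x) Ss) (sym (outer (λ x → x) Ss)) (listedPaths-↭ (λ x → x) Ss))))
  where
  inner-blocks : ∀ i g bs → concatMap (λ { (l , b) → map (inner i l) (upTo b) }) (zip (applyUpTo g (length bs)) bs)
                            ≡ forwardBlocks i g bs
  inner-blocks i g []       = Eq.refl
  inner-blocks i g (b ∷ bs) = cong (block i (g 0) b ++_) (inner-blocks i (λ x → g (suc x)) bs)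
  outer : ∀ g Ss → concatMap (λ { (i , S) → concatMap (λ { (l , b) → map (inner i l) (upTo b) })
                                                      (zip (upTo (length (toList S))) (toList S)) })
                             (zip (applyUpTo g (length Ss)) Ss)
                   ≡ listedPaths g Ss
  outer g []       = Eq.refl
  outer g (S ∷ Ss) = cong₂ _++_ (inner-blocks (g 0) (λ x → x) (toList S)) (outer (λ x → g (suc x)) Ss)

OnPaths : (ℕ → ℕ) → TV → Set
OnPaths g (inner i _ _) = Σ ℕ (λ p → i ≡ g p)
OnPaths g _             = ⊥

allPaths-on : ∀ g Ss → All (OnPaths g) (allPaths g Ss)
allPaths-on g []       = []
allPaths-on g (S ∷ Ss) = AllP.++⁺
  (All.map (λ { {inner _ _ _} (i≡ , _) → 0 , i≡ }) (pathVerts-in (g 0) (reverse (toList S))))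
  (All.map (λ { {inner _ _ _} (p , i≡) → suc p , i≡ }) (allPaths-on (λ x → g (suc x)) Ss))

-- Counting the colourings of T(1, S₁, …, Sₙ, k): colour the apex (q ways), then the
-- final clique, then the paths, which are independent given the colours of the apex
-- and the final clique and depend on the latter only through whether it uses the
-- apex colour.
module ThetaColourings (Ss : List (List⁺ ℕ)) (k q : ℕ) where
  adj = thetaAdj Ss
  open Sequential adj q
  open Cliques adj q

  X : ℤ
  X = + q

  finalClique : List TV
  finalClique = map final (upTo k)

  paths : List TV
  paths = allPaths (λ x → x) Ss

  pathsTotal : Bool → ℤ
  pathsTotal used = prodZ (λ S → pathCount X (reverse (toList S)) k used) Ss

  afterApex : ℤ
  afterApex = + k * (X - 1ℤ) ↓ (k ∸ 1) * pathsTotal true + (X - 1ℤ) ↓ k * pathsTotal false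

  nearFinal : TV → Bool
  nearFinal w = adj w (final 0)

  apexColoured : ℕ → Constraint
  apexColoured a = forbid apex a (λ _ _ → true)

  distinct-paths : ∀ i rs g Ss′ → (∀ p → ¬ i ≡ g p) → NoEdges (pathVerts i rs) (allPaths g Ss′)
  distinct-paths i rs g Ss′ i∉g = All.map
    (λ { {inner .i l c} (Eq.refl , _) → All.map (λ { {inner i′ l′ c′} (p , i′≡) →
           no-edge l c l′ c′ i′ (λ i′≡i → i∉g p (Eq.trans (sym i′≡i) i′≡)) }) (allPaths-on g Ss′) })
    (pathVerts-in i rs)
    where
    no-edge : ∀ l c l′ c′ i′ → ¬ i′ ≡ i → adj (inner i′ l′ c′) (inner i l c) ≡ false
    no-edge l c l′ c′ i′ i′≢i rewrite ≢⇒≡ᵇ-false i′≢i | ≢⇒≡ᵇ-false {i} {i′} (λ e → i′≢i (sym e)) = Eq.refl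

  module _ (a : ℕ) (a<q : a < q) (κ : List ℕ) (dκ : Distinct κ) (bκ : All (_< q) κ) where

    onPaths : Constraint
    onPaths = avoiding (apexColoured a) nearFinal κ

    paths-count : ∀ g Ss′ → (∀ p → lenAt Ss (g p) ≡ lenAt Ss′ p) → (∀ x y → g x ≡ g y → x ≡ y) →
      cnt (allPaths g Ss′) onPaths ≡ prodZ (λ S → pathCount X (reverse (toList S)) (length κ) (elemᵇ a κ)) Ss′
    paths-count g []        _      _     = Eq.refl
    paths-count g (S ∷ Ss′) g-lens g-inj =
      Eq.trans (cnt-++-independent (pathVerts (g 0) rs) (allPaths (λ x → g (suc x)) Ss′) onPaths
                  (distinct-paths (g 0) rs (λ x → g (suc x)) Ss′ (λ p e → zero≢suc (g-inj 0 (suc p) e))))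
        (cong₂ _*_ (this-path rs (subst (1 ≤_) (sym (LP.length-reverse (toList S))) (s≤s z≤n)) constrained)
                   (paths-count (λ x → g (suc x)) Ss′ (λ p → g-lens (suc p))
                                (λ x y e → NP.suc-injective (g-inj (suc x) (suc y) e))))
      where
      open PathColourings Ss q a a<q (g 0) using (pathConstraint; PathConstrained; path-count)
      rs = reverse (toList S)
      zero≢suc : ∀ {p} → ¬ 0 ≡ suc p
      zero≢suc ()
      this-path : ∀ rs → 1 ≤ length rs → PathConstrained (length rs) κ onPaths (pathVerts (g 0) rs) →
                  cnt (pathVerts (g 0) rs) onPaths ≡ pathCount X rs (length κ) (elemᵇ a κ)
      this-path (b ∷ rs) _ = path-count b rs κ onPaths dκ bκ
      path-length : lenAt Ss (g 0) ≡ length rs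
      path-length = Eq.trans (g-lens 0) (sym (LP.length-reverse (toList S)))
      constrained : PathConstrained (length rs) κ onPaths (pathVerts (g 0) rs)
      constrained = All.map (λ { {inner .(g 0) l c} (Eq.refl , _) d →
        cong (λ z → not ((l ≡ᵇ 0) ∧ (d ≡ᵇ a)) ∧ not (z ∧ elemᵇ d κ))
             (Eq.trans (BP.∨-identityʳ _) (cong (suc l ≡ᵇ_) path-length)) }) (pathVerts-in (g 0) rs)

  final-clique : IsClique finalClique
  final-clique = clique (upTo k) (upTo⁺ k)
    where
    clique : ∀ cs → Unique cs → IsClique (map final cs)
    clique []       []           = []
    clique (c ∷ cs) (c∉ ∷ uniq) = edges cs c∉ ∷ clique cs uniq
      where
      edges : ∀ ds → All (λ d → ¬ c ≡ d) ds → All (λ w → adj w (final c) ≡ true) (map final ds)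
      edges []       []         = []
      edges (d ∷ ds) (c≢d ∷ ns) = edge ∷ edges ds ns
        where edge : adj (final d) (final c) ≡ true
              edge rewrite ≢⇒≡ᵇ-false {d} {c} (λ e → c≢d (sym e)) = Eq.refl

  after-apex : ∀ a → a < q → cnt (finalClique ++ paths) (apexColoured a) ≡ afterApex
  after-apex a a<q = begin
    cnt (finalClique ++ paths) (apexColoured a)
      ≡⟨ cnt-clique finalClique paths nearFinal (λ _ → true) (apexColoured a) (apexColoured a) []
                    final-clique near fresh-final (All.universal (avoiding-nothing (apexColoured a) nearFinal) paths) ⟩
    injSum (length finalClique) [] g
      ≡⟨ cong (λ n → injSum n [] g) (Eq.trans (LP.length-map final (upTo k)) (LP.length-upTo k)) ⟩
    injSum k [] g
      ≡⟨ injSum-special k a<q (start (count-all q)) Eq.refl Eq.refl ⟩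
    afterApex ∎
    where
    open InjectiveChoices q (λ _ → true)
    g : List ℕ → ℤ
    g κ = cnt paths (avoiding (apexColoured a) nearFinal κ)
    by-paths : ∀ κ → Distinct κ → All (_< q) κ → length κ ≡ k → g κ ≡ pathsTotal (elemᵇ a κ)
    by-paths κ dκ bκ |κ| = Eq.trans (paths-count a a<q κ dκ bκ (λ x → x) Ss (λ _ → Eq.refl) (λ _ _ e → e))
                                    (cong (λ s → prodZ (λ S → pathCount X (reverse (toList S)) s (elemᵇ a κ)) Ss) |κ|)
    open SpecialColour a pathsTotal g k by-paths
    near : All (λ v → All (λ w → adj v w ≡ nearFinal v) finalClique) paths
    near = All.map (λ { {inner _ _ _} _ → AllP.map⁺ (All.universal (λ _ → Eq.refl) (upTo k)) })
                   (allPaths-on (λ x → x) Ss)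
    fresh-final : All (λ w → ∀ d → apexColoured a w d ≡ fresh [] d) finalClique
    fresh-final = AllP.map⁺ (All.universal (λ _ _ → Eq.refl) (upTo k))

  theta-count : cnt (apex ∷ (finalClique ++ paths)) (λ _ _ → true) ≡ X * afterApex
  theta-count = begin
    Σ< q (λ a → cnt (finalClique ++ paths) (apexColoured a)) ≡⟨ Σ<-cong q (λ a a<q → after-apex a a<q) ⟩
    Σ< q (λ _ → afterApex)                                  ≡⟨ Σ<-const q (λ _ → true) afterApex ⟩
    count q (λ _ → true) * afterApex                        ≡⟨ cong (_* afterApex) (count-all q) ⟩
    X * afterApex                                           ∎

chainFactor : ℤ → List ℕ → ℕ → ℤ
chainFactor x []       s = 1ℤ
chainFactor x (b ∷ rs) s = ((x - + s) - 1ℤ) ↓ (b ∸ 1) * chainFactor x rs b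

pathCount-closed : ∀ x rs s → All (1 ≤_) rs →
  (pathCount x rs s true ≡ (x - + s) * chainFactor x rs s * rRev x rs) ×
  (pathCount x rs s false ≡ chainFactor x rs s * rRev x (s ∷ rs))
pathCount-closed x []       s []            = base-used (x - + s) , base-unused (x - + s)
  where base-used : ∀ y → 0ℤ ≡ y * 1ℤ * 0ℤ
        base-used = solve-∀
        base-unused : ∀ y → 1ℤ ≡ 1ℤ * (y * 0ℤ + 1ℤ)
        base-unused = solve-∀
pathCount-closed x (suc b ∷ rs) s (s≤s z≤n ∷ pos) = used , unused
  where
  IH = pathCount-closed x rs (suc b) pos
  F = ((x - + s) - 1ℤ) ↓ b
  G = chainFactor x rs (suc b)
  used : pathCount x (suc b ∷ rs) s true ≡ (x - + s) * chainFactor x (suc b ∷ rs) s * rRev x (suc b ∷ rs)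
  used = Eq.trans (cong ((x - + s) ↓ suc b *_) (proj₂ IH))
                  (lem (x - + s) F G (rRev x (suc b ∷ rs)))
    where lem : ∀ y f g r → (y * f) * (g * r) ≡ y * (f * g) * r
          lem = solve-∀
  unused : pathCount x (suc b ∷ rs) s false ≡ chainFactor x (suc b ∷ rs) s * rRev x (s ∷ suc b ∷ rs)
  unused = begin
    + suc b * F * pathCount x rs (suc b) true + ((x - + s) - 1ℤ) ↓ suc b * pathCount x rs (suc b) false
      ≡⟨ cong₂ (λ u v → + suc b * F * u + ((x - + s) - 1ℤ) ↓ suc b * v) (proj₁ IH) (proj₂ IH) ⟩
    + suc b * F * ((x - + suc b) * G * rRev x rs) + ((x - + s) - 1ℤ) ↓ suc b * (G * rRev x (suc b ∷ rs))
      ≡⟨ cong (λ z → + suc b * F * ((x - + suc b) * G * rRev x rs) + z * (G * rRev x (suc b ∷ rs)))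
              (↓-last ((x - + s) - 1ℤ) b) ⟩
    + suc b * F * ((x - + suc b) * G * rRev x rs) + F * (((x - + s) - 1ℤ) - + b) * (G * rRev x (suc b ∷ rs))
      ≡⟨ lem x (+ s) (+ b) F G (rRev x rs) (negProd rs) ⟩
    (F * G) * rRev x (s ∷ suc b ∷ rs) ∎
    where lem : ∀ x s b f g r n →
                (1ℤ + b) * f * ((x - (1ℤ + b)) * g * r) + f * ((x - s - 1ℤ) - b) * (g * ((x - (1ℤ + b)) * r + n))
                ≡ (f * g) * ((x - s) * ((x - (1ℤ + b)) * r + n) + (- (1ℤ + b)) * n)
          lem = solve-∀

consecPairs-∷ʳ : ∀ xs b s → consecPairs ((xs ++ b ∷ []) ++ s ∷ []) ≡ consecPairs (xs ++ b ∷ []) ++ (b , s) ∷ []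
consecPairs-∷ʳ []            b s = Eq.refl
consecPairs-∷ʳ (x ∷ [])      b s = Eq.refl
consecPairs-∷ʳ (x ∷ y ∷ xs)  b s = cong ((x , y) ∷_) (consecPairs-∷ʳ (y ∷ xs) b s)

last-split : ∀ (S : List⁺ ℕ) → Σ (List ℕ) (λ ys → toList S ≡ ys ++ last S ∷ [])
last-split (x ∷ xs) with initLast xs
... | []       = [] , Eq.refl
... | ys ∷ʳ′ y = x ∷ ys , Eq.refl

last-positive : ∀ S → All (1 ≤_) (toList S) → 1 ≤ last S
last-positive S pos with last-split S
... | ys , S≡ = All.head (AllP.++⁻ʳ ys (subst (All (1 ≤_)) S≡ pos))

module Chains (x : ℤ) where
  link : ℕ × ℕ → ℤ
  link (a , a′) = ((x - + a′) - 1ℤ) ↓ (a ∸ 1)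

  chainFactor-links : ∀ rs s → chainFactor x rs s ≡ prodZ link (consecPairs (reverse rs ++ s ∷ []))
  chainFactor-links []       s = Eq.refl
  chainFactor-links (b ∷ rs) s = begin
    link (b , s) * chainFactor x rs b
      ≡⟨ cong (link (b , s) *_) (chainFactor-links rs b) ⟩
    link (b , s) * prodZ link (consecPairs (reverse rs ++ b ∷ []))
      ≡⟨ ZP.*-comm (link (b , s)) _ ⟩
    prodZ link (consecPairs (reverse rs ++ b ∷ [])) * link (b , s)
      ≡⟨ cong (prodZ link (consecPairs (reverse rs ++ b ∷ [])) *_) (sym (ZP.*-identityʳ (link (b , s)))) ⟩
    prodZ link (consecPairs (reverse rs ++ b ∷ [])) * prodZ link ((b , s) ∷ [])
      ≡⟨ sym (prodZ-++ link (consecPairs (reverse rs ++ b ∷ [])) _) ⟩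
    prodZ link (consecPairs (reverse rs ++ b ∷ []) ++ (b , s) ∷ [])
      ≡⟨ cong (prodZ link) (sym (consecPairs-∷ʳ (reverse rs) b s)) ⟩
    prodZ link (consecPairs ((reverse rs ++ b ∷ []) ++ s ∷ []))
      ≡⟨ cong (λ l → prodZ link (consecPairs (l ++ s ∷ []))) (sym (LP.unfold-reverse b rs)) ⟩
    prodZ link (consecPairs (reverse (b ∷ rs) ++ s ∷ [])) ∎

  chainFactor-path : ∀ S k → chainFactor x (reverse (toList S)) k
                             ≡ ((x - + k) - 1ℤ) ↓ (last S ∸ 1) * prodZ link (consecPairs (toList S))
  chainFactor-path S k with last-split S
  ... | ys , S≡ = begin
    chainFactor x (reverse (toList S)) k
      ≡⟨ chainFactor-links (reverse (toList S)) k ⟩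
    prodZ link (consecPairs (reverse (reverse (toList S)) ++ k ∷ []))
      ≡⟨ cong (λ l → prodZ link (consecPairs (l ++ k ∷ []))) (Eq.trans (LP.reverse-involutive (toList S)) S≡) ⟩
    prodZ link (consecPairs ((ys ++ last S ∷ []) ++ k ∷ []))
      ≡⟨ cong (prodZ link) (consecPairs-∷ʳ ys (last S) k) ⟩
    prodZ link (consecPairs (ys ++ last S ∷ []) ++ (last S , k) ∷ [])
      ≡⟨ prodZ-++ link (consecPairs (ys ++ last S ∷ [])) _ ⟩
    prodZ link (consecPairs (ys ++ last S ∷ [])) * (link (last S , k) * 1ℤ)
      ≡⟨ cong₂ (λ l z → prodZ link (consecPairs l) * z) (sym S≡) (ZP.*-identityʳ _) ⟩
    prodZ link (consecPairs (toList S)) * link (last S , k)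
      ≡⟨ ZP.*-comm _ (link (last S , k)) ⟩
    link (last S , k) * prodZ link (consecPairs (toList S)) ∎

module Evaluation (S₀ : List (List⁺ ℕ)) (Sn : List⁺ ℕ) (k : ℕ) where
  Ss : List (List⁺ ℕ)
  Ss = S₀ ++ Sn ∷ []

  module _ (x : ℤ) where
    open Chains x using (link)

    top : List⁺ ℕ → ℤ
    top S = ((x - + k) - 1ℤ) ↓ (last S ∸ 1)

    links : List⁺ ℕ → ℤ
    links S = prodZ link (consecPairs (toList S))

    R R′ : List⁺ ℕ → ℤ
    R  S = evalP (r (toList S)) x
    R′ S = evalP (r (toList S ++ k ∷ [])) x

    rhs-factors : evalP (prop4RHS S₀ Sn k) x
                  ≡ (x ↓ (last Sn ℕ.+ k) * prodZ top S₀ * prodZ links Ss)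
                    * (+ k * (x - + k) ^ length S₀ * prodZ R Ss + prodZ R′ Ss)
    rhs-factors = begin
      evalP ((A₁ *P A₂ *P A₃) *P (B₁ +P B₂)) x
        ≡⟨ evalP-* (A₁ *P A₂ *P A₃) (B₁ +P B₂) x ⟩
      evalP (A₁ *P A₂ *P A₃) x * evalP (B₁ +P B₂) x
        ≡⟨ cong₂ _*_ (Eq.trans (evalP-* (A₁ *P A₂) A₃ x) (cong₂ _*_ (Eq.trans (evalP-* A₁ A₂ x) (cong₂ _*_ a₁ a₂)) a₃))
                     (Eq.trans (evalP-+ B₁ B₂ x) (cong₂ _+_ b₁ b₂)) ⟩
      (x ↓ (last Sn ℕ.+ k) * prodZ top S₀ * prodZ links Ss)
        * (+ k * (x - + k) ^ length S₀ * prodZ R Ss + prodZ R′ Ss) ∎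
      where
      pair : ℕ × ℕ → Poly
      pair p = fall (suc (proj₂ p)) (proj₁ p ∸ 1)
      A₁ = fall 0 (last Sn ℕ.+ k)
      A₂ = prodP (map (λ S → fall (suc k) (last S ∸ 1)) S₀)
      A₃ = prodP (map (λ S → prodP (map pair (consecPairs (toList S)))) Ss)
      B₁ = constP (+ k) *P powP (X- k) (length S₀) *P prodP (map (λ S → r (toList S)) Ss)
      B₂ = prodP (map (λ S → r (toList S ++ k ∷ [])) Ss)
      a₁ : evalP A₁ x ≡ x ↓ (last Sn ℕ.+ k)
      a₁ = evalP-fall-0 (last Sn ℕ.+ k) x
      a₂ : evalP A₂ x ≡ prodZ top S₀
      a₂ = Eq.trans (evalP-prod (λ S → fall (suc k) (last S ∸ 1)) S₀ x) (prodZ-cong′ S₀ (λ S → evalP-fall-suc k (last S ∸ 1) x))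
      a₃ : evalP A₃ x ≡ prodZ links Ss
      a₃ = Eq.trans (evalP-prod (λ S → prodP (map pair (consecPairs (toList S)))) Ss x) (prodZ-cong′ Ss (λ S →
             Eq.trans (evalP-prod pair (consecPairs (toList S)) x)
                      (prodZ-cong′ (consecPairs (toList S)) (λ p → evalP-fall-suc (proj₂ p) (proj₁ p ∸ 1) x))))
      b₁ : evalP B₁ x ≡ + k * (x - + k) ^ length S₀ * prodZ R Ss
      b₁ = Eq.trans (evalP-* (constP (+ k) *P powP (X- k) (length S₀)) (prodP (map (λ S → r (toList S)) Ss)) x)
             (cong₂ _*_ (Eq.trans (evalP-* (constP (+ k)) (powP (X- k) (length S₀)) x)
                          (cong₂ _*_ (evalP-const (+ k) x)
                                     (Eq.trans (evalP-pow (X- k) (length S₀) x) (cong (_^ length S₀) (evalP-X- k x)))))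
                        (evalP-prod (λ S → r (toList S)) Ss x))
      b₂ : evalP B₂ x ≡ prodZ R′ Ss
      b₂ = evalP-prod (λ S → r (toList S ++ k ∷ [])) Ss x

  module _ (n : ℕ) where
    x : ℤ
    x = + suc n
    open Chains x using (link; chainFactor-path)

    Y : ℤ
    Y = x - + k

    path-factors : ∀ S → All (1 ≤_) (toList S) →
      (pathCount x (reverse (toList S)) k true ≡ Y * (top x S * links x S) * R x S) ×
      (pathCount x (reverse (toList S)) k false ≡ (top x S * links x S) * R′ x S)
    path-factors S pos =
      Eq.trans (proj₁ closed) (cong₂ (λ c v → Y * c * v) (chainFactor-path S k) (sym (evalP-r-rRev (toList S) n))) ,
      Eq.trans (proj₂ closed) (cong₂ _*_ (chainFactor-path S k)
        (sym (Eq.trans (evalP-r-rRev (toList S ++ k ∷ []) n) (cong (rRev x) (LP.reverse-++ (toList S) (k ∷ []))))))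
      where closed = pathCount-closed x (reverse (toList S)) k
                       (PermP.All-resp-↭ (↭-sym (PermP.↭-reverse (toList S))) pos)

    open ThetaColourings Ss k (suc n) using (afterApex; pathsTotal)

    -- Multiplying by the apex's q choices turns (q-1)↓(k-1) and (q-1)↓k into q↓k.
    apex-absorbed : 1 ≤ k → x * afterApex ≡ + k * x ↓ k * pathsTotal true + x ↓ k * Y * pathsTotal false
    apex-absorbed (s≤s {n = k′} z≤n) = begin
      x * afterApex
        ≡⟨ distribute x (+ k) ((x - 1ℤ) ↓ k′) ((x - 1ℤ) ↓ k) (pathsTotal true) (pathsTotal false) ⟩
      + k * x ↓ k * pathsTotal true + (x * (x - 1ℤ) ↓ k) * pathsTotal false
        ≡⟨ cong (λ z → + k * x ↓ k * pathsTotal true + z * pathsTotal false) (↓-last x k) ⟩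
      + k * x ↓ k * pathsTotal true + x ↓ k * Y * pathsTotal false ∎
      where distribute : ∀ x K f₁ f₂ t u → x * (K * f₁ * t + f₂ * u) ≡ K * (x * f₁) * t + (x * f₂) * u
            distribute = solve-∀

    module _ (pos : All (λ S → All (1 ≤_) (toList S)) Ss) where
      Pt Pl PR PR′ : ℤ
      Pt  = prodZ (top x) S₀
      Pl  = prodZ (links x) S₀
      PR  = prodZ (R x) S₀
      PR′ = prodZ (R′ x) S₀

      last-path : ∀ f → prodZ f Ss ≡ prodZ f S₀ * (f Sn * 1ℤ)
      last-path f = prodZ-++ f S₀ (Sn ∷ [])

      used-total : pathsTotal true ≡ Y ^ length S₀ * (Pt * Pl * PR) * (Y * (top x Sn * links x Sn) * R x Sn * 1ℤ)
      used-total = begin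
        pathsTotal true
          ≡⟨ prodZ-cong Ss pos (λ S p → proj₁ (path-factors S p)) ⟩
        prodZ (λ S → Y * (top x S * links x S) * R x S) Ss
          ≡⟨ last-path (λ S → Y * (top x S * links x S) * R x S) ⟩
        prodZ (λ S → Y * (top x S * links x S) * R x S) S₀ * lastUsed
          ≡⟨ cong (_* lastUsed) (prodZ-* (λ S → Y * (top x S * links x S)) (R x) S₀) ⟩
        prodZ (λ S → Y * (top x S * links x S)) S₀ * PR * lastUsed
          ≡⟨ cong (λ z → z * PR * lastUsed) (Eq.trans (prodZ-scale Y _ S₀) (cong (Y ^ length S₀ *_) (prodZ-* (top x) (links x) S₀))) ⟩
        Y ^ length S₀ * (Pt * Pl) * PR * lastUsed
          ≡⟨ cong (_* lastUsed) (ZP.*-assoc (Y ^ length S₀) (Pt * Pl) PR) ⟩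
        Y ^ length S₀ * (Pt * Pl * PR) * lastUsed ∎
        where lastUsed = Y * (top x Sn * links x Sn) * R x Sn * 1ℤ

      unused-total : pathsTotal false ≡ Pt * Pl * PR′ * ((top x Sn * links x Sn) * R′ x Sn * 1ℤ)
      unused-total = Eq.trans (prodZ-cong Ss pos (λ S p → proj₂ (path-factors S p)))
                       (Eq.trans (last-path (λ S → (top x S * links x S) * R′ x S))
                                 (cong (_* ((top x Sn * links x Sn) * R′ x Sn * 1ℤ)) (prodZ-*₃ (top x) (links x) (R′ x) S₀)))

      -- The factor X↓(a_n + k) of the formula: the final clique and the top block of path n.
      top-clique : x ↓ (last Sn ℕ.+ k) ≡ x ↓ k * (Y * top x Sn)
      top-clique = begin
        x ↓ (last Sn ℕ.+ k)           ≡⟨ cong (x ↓_) (NP.+-comm (last Sn) k) ⟩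
        x ↓ (k ℕ.+ last Sn)           ≡⟨ ↓-+ x k (last Sn) ⟩
        x ↓ k * Y ↓ last Sn           ≡⟨ cong (x ↓ k *_) (unfold (last-positive Sn (All.head (AllP.++⁻ʳ S₀ pos)))) ⟩
        x ↓ k * (Y * top x Sn)        ∎
        where unfold : ∀ {m} → 1 ≤ m → Y ↓ m ≡ Y * (Y - 1ℤ) ↓ (m ∸ 1)
              unfold (s≤s z≤n) = Eq.refl

      count-formula : 1 ≤ k → x * afterApex ≡ evalP (prop4RHS S₀ Sn k) x
      count-formula k≥1 = begin
        x * afterApex
          ≡⟨ apex-absorbed k≥1 ⟩
        + k * x ↓ k * pathsTotal true + x ↓ k * Y * pathsTotal false
          ≡⟨ cong₂ (λ u v → + k * x ↓ k * u + x ↓ k * Y * v) used-total unused-total ⟩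
        + k * x ↓ k * (Y ^ length S₀ * (Pt * Pl * PR) * (Y * (top x Sn * links x Sn) * R x Sn * 1ℤ))
          + x ↓ k * Y * (Pt * Pl * PR′ * ((top x Sn * links x Sn) * R′ x Sn * 1ℤ))
          ≡⟨ regroup (x ↓ k) Y (top x Sn) (links x Sn) (R x Sn) (R′ x Sn) Pt Pl PR PR′ (+ k) (Y ^ length S₀) ⟩
        (x ↓ k * (Y * top x Sn) * Pt * (Pl * (links x Sn * 1ℤ)))
          * (+ k * Y ^ length S₀ * (PR * (R x Sn * 1ℤ)) + PR′ * (R′ x Sn * 1ℤ))
          ≡⟨ sym (cong₂ (λ u v → u * (+ k * Y ^ length S₀ * v + PR′ * (R′ x Sn * 1ℤ)))
                        (cong₂ (λ u v → u * Pt * v) top-clique (last-path (links x))) (last-path (R x))) ⟩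
        (x ↓ (last Sn ℕ.+ k) * Pt * prodZ (links x) Ss)
          * (+ k * Y ^ length S₀ * prodZ (R x) Ss + PR′ * (R′ x Sn * 1ℤ))
          ≡⟨ cong (λ v → (x ↓ (last Sn ℕ.+ k) * Pt * prodZ (links x) Ss) * (+ k * Y ^ length S₀ * prodZ (R x) Ss + v))
                  (sym (last-path (R′ x))) ⟩
        (x ↓ (last Sn ℕ.+ k) * Pt * prodZ (links x) Ss)
          * (+ k * Y ^ length S₀ * prodZ (R x) Ss + prodZ (R′ x) Ss)
          ≡⟨ sym (rhs-factors x) ⟩
        evalP (prop4RHS S₀ Sn k) x ∎
        where
        regroup : ∀ fk y tn ln rn rn′ pt pl pr pr′ K yn →
          K * fk * (yn * (pt * pl * pr) * (y * (tn * ln) * rn * 1ℤ)) + fk * y * (pt * pl * pr′ * ((tn * ln) * rn′ * 1ℤ))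
          ≡ (fk * (y * tn) * pt * (pl * (ln * 1ℤ))) * (K * yn * (pr * (rn * 1ℤ)) + pr′ * (rn′ * 1ℤ))
        regroup = solve-∀

  -- Both sides vanish at q = 0, the right-hand side through its factor X↓(a_n + k).
  formula-at-0 : 1 ≤ k → evalP (prop4RHS S₀ Sn k) 0ℤ ≡ 0ℤ
  formula-at-0 (s≤s {n = k′} z≤n) = begin
    evalP (prop4RHS S₀ Sn k) 0ℤ      ≡⟨ rhs-factors 0ℤ ⟩
    (0ℤ ↓ (last Sn ℕ.+ k) * A * B) * C ≡⟨ cong (λ m → (0ℤ ↓ m * A * B) * C) (NP.+-suc (last Sn) k′) ⟩
    (0ℤ * F * A * B) * C             ≡⟨ vanish F A B C ⟩
    0ℤ                               ∎
    where
    F = (0ℤ - 1ℤ) ↓ (last Sn ℕ.+ k′)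
    A = prodZ (top 0ℤ) S₀
    B = prodZ (links 0ℤ) Ss
    C = + k * (0ℤ - + k) ^ length S₀ * prodZ (R 0ℤ) Ss + prodZ (R′ 0ℤ) Ss
    vanish : ∀ f a b c → (0ℤ * f * a * b) * c ≡ 0ℤ
    vanish = solve-∀

proposition4 : (S₀ : List (List⁺ ℕ)) (Sn : List⁺ ℕ) (k : ℕ) → 1 ≤ k →
    All (λ S → All (λ a → 1 ≤ a) (toList S)) (S₀ ++ Sn ∷ []) →
    (q : ℕ) →
    + numColourings (cliqueTheta (S₀ ++ Sn ∷ []) k) q ≡ evalP (prop4RHS S₀ Sn k) (+ q)
proposition4 S₀ Sn k k≥1 pos q = begin
  + numColourings (cliqueTheta Ss k) q
    ≡⟨ numColourings≡cnt (cliqueTheta Ss k) (thetaAdj-sym Ss) q ⟩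
  cnt (thetaVerts Ss k) (λ _ _ → true)
    ≡⟨ cnt-↭ (thetaVerts-↭ Ss k) (λ _ _ → true) ⟩
  cnt (apex ∷ (finalClique ++ paths)) (λ _ _ → true)
    ≡⟨ theta-count ⟩
  + q * afterApex
    ≡⟨ formula q ⟩
  evalP (prop4RHS S₀ Sn k) (+ q) ∎
  where
  open Evaluation S₀ Sn k using (Ss; count-formula; formula-at-0)
  open Sequential (thetaAdj Ss) q using (cnt)
  open Symmetric (thetaAdj Ss) (thetaAdj-sym Ss) q using (cnt-↭)
  open ThetaColourings Ss k q using (finalClique; paths; theta-count; afterApex)
  formula : ∀ q → + q * ThetaColourings.afterApex Ss k q ≡ evalP (prop4RHS S₀ Sn k) (+ q)
  formula zero    = Eq.trans (ZP.*-zeroˡ (ThetaColourings.afterApex Ss k 0)) (sym (formula-at-0 k≥1))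
  formula (suc n) = count-formula n pos k≥1
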